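{- Let $\mathcal A\subseteq\mathcal P([n])$ be a counterexample to the union-closed conjecture, let $\mathcal B=\mathcal P([n])\setminus\mathcal A$ with $m=|\mathcal B|$, and let $p\in[0,1/2]$. If some element of $[n]$ lies in exactly $m(1/2+p)$ sets of $\mathcal B$, then \[ \|\mathcal I(m)\|>m\left(\frac n2-1+p\right). \]
   Context: A family $\mathcal A$ is union-closed if $A\cup B\in\mathcal A$ whenever $A,B\in\mathcal A$. $\deg_{\mathcal A}(i)=|\{A\in\mathcal A:i\in A\}|$. A counterexample to the union-closed conjecture is a union-closed family $\mathcal A\neq\{\emptyset\}$ with $\deg_{\mathcal A}(i)<|\mathcal A|/2$ for every positive integer $i$. $\|\mathcal F\|=\sum_{F\in\mathcal F}|F|$. The colex order: $A<B$ iff $\max(A\triangle B)\in B$; $\mathcal I(m)$ is the family of the first $m$ finite sets of positive integers in this order.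
   Formalization: The parameter p ranges over the rationals in [0,1/2]. -}

module Defs where

open import Data.Nat using (ℕ; _≤_; _<_; _*_)
open import Data.Nat.Properties using (_≟_)
open import Data.List using (List; []; _∷_; [_]; length; filter; map)
open import Data.Nat.ListAction using (sum)
open import Data.List.Relation.Unary.All using (All)
open import Data.List.Relation.Unary.Linked using (Linked)
open import Data.List.Relation.Unary.Unique.Propositional using (Unique)
open import Data.List.Membership.Propositional using (_∈_; _∉_)
open import Data.List.Membership.DecPropositional _≟_ using (_∈?_)
open import Data.Product using (_×_; ∃-syntax)
open import Data.Sum using (_⊎_)
open import Relation.Binary.PropositionalEquality using (_≡_; _≢_)
open import Relation.Nullary using (¬_)

-- A finite set of positive integers, represented canonically as the
-- strictly decreasing list of its elements (so list equality = set equality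
-- and the length of the list is the cardinality).
FinSet : Set
FinSet = List ℕ

IsFinSetPos : FinSet → Set
IsFinSetPos X = All (λ x → 1 ≤ x) X × Linked (λ a b → b < a) X

InPow : ℕ → FinSet → Set
InPow n X = IsFinSetPos X × All (λ x → x ≤ n) X

-- A family of sets: a duplicate-free list of canonical sets.
Family : Set
Family = List FinSet

IsFamilyIn : ℕ → Family → Set
IsFamilyIn n 𝒜 = All (InPow n) 𝒜 × Unique 𝒜

UnionClosed : Family → Set
UnionClosed 𝒜 = ∀ X Y → X ∈ 𝒜 → Y ∈ 𝒜 →
  ∃[ Z ] (Z ∈ 𝒜 × (∀ x → (x ∈ Z → x ∈ X ⊎ x ∈ Y) × (x ∈ X ⊎ x ∈ Y → x ∈ Z)))

deg : ℕ → Family → ℕ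
deg i 𝒜 = length (filter (λ X → i ∈? X) 𝒜)

norm : Family → ℕ
norm 𝓕 = sum (map length 𝓕)

Counterexample : ℕ → Family → Set
Counterexample n 𝒜 =
  IsFamilyIn n 𝒜 × UnionClosed 𝒜 × 𝒜 ≢ [ [] ] ×
  (∀ i → 1 ≤ i → 2 * deg i 𝒜 < length 𝒜)

IsComplementIn : ℕ → Family → Family → Set
IsComplementIn n 𝒜 ℬ =
  IsFamilyIn n ℬ × (∀ X → InPow n X → (X ∈ ℬ → X ∉ 𝒜) × (X ∉ 𝒜 → X ∈ ℬ))

-- Colex order: A < B iff max(A △ B) ∈ B, i.e. there is x ∈ B ∖ A such that
-- A and B agree on all y > x.
_<colex_ : FinSet → FinSet → Set
A <colex B = ∃[ x ] (x ∈ B × x ∉ A × (∀ y → x < y → (y ∈ A → y ∈ B) × (y ∈ B → y ∈ A)))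

-- 𝓕 is 𝓘(m): the first m finite sets of positive integers in colex order,
-- i.e. a family of m distinct finite sets of positive integers closed
-- downward under the colex order.
IsInitialColex : Family → ℕ → Set
IsInitialColex 𝓕 m =
  All IsFinSetPos 𝓕 × Unique 𝓕 × length 𝓕 ≡ m ×
  (∀ A → A ∈ 𝓕 → ∀ B → IsFinSetPos B → B <colex A → B ∈ 𝓕)

module Submission where

-- (a) Each j ∈ [n] lies in more than m/2 sets of ℬ (X ↦ X ∪ {j} shows j lies
--     in half of 𝒫([n]), but in fewer than half of 𝒜); summing over [n] with
--     the term i kept exact and double counting, 2d + (n-1)(m+1) ≤ 2‖ℬ‖.
-- (b) By union-closure of 𝒜, B ∈ ℬ has at most one j with B ∖ {j} ∉ ℬ, so
--     ‖ℬ‖ ≤ e(ℬ) + m, where e counts the hypercube edges inside ℬ.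
-- (c) Edge-isoperimetric inequality: e(ℬ) ≤ h(m) = Σ_{k<m} popcount(k), by
--     induction on n using h(a) + h(b) + min(a,b) ≤ h(a+b).
-- (d) h(m) ≤ ‖𝓘(m)‖: the binary code X ↦ Σ_{x∈X} 2^(x-1) maps 𝓘(m) onto
--     {0, …, m-1} and the size of a set to the popcount of its code.
-- As n ≥ 2, this gives mn + 2d < 2‖𝓘(m)‖ + 3m, i.e. the claim over ℚ.

module Counting where

  open import Data.Nat using (ℕ; suc; _+_; _≤_; z≤n; s≤s)
  open import Data.Nat.Properties
  open import Data.Nat.ListAction using (sum)
  open import Data.List using (List; []; _∷_; _++_; length; filter; map)
  open import Data.List.Properties using (length-++-sucʳ; map-cong)
  open import Data.List.Relation.Unary.All using (All; []; _∷_)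
  import Data.List.Relation.Unary.All as All
  open import Data.List.Relation.Unary.Any using (here; there)
  open import Data.List.Relation.Unary.AllPairs using ([]; _∷_)
  open import Data.List.Relation.Unary.Unique.Propositional using (Unique)
  open import Data.List.Membership.Propositional using (_∈_; _∉_)
  open import Data.List.Membership.Propositional.Properties using (∈-∃++; ∈-map⁻)
  open import Data.Product using (_×_; _,_)
  open import Data.Empty using (⊥-elim)
  open import Relation.Nullary using (Dec; yes; no; ¬?)
  open import Relation.Unary using (Pred; Decidable)
  open import Relation.Binary.PropositionalEquality using (_≡_; _≢_; refl; sym; trans; cong; cong₂; subst; module ≡-Reasoning)
  open import Data.Nat.Tactic.RingSolver using (solve-∀)
  open import Function using (_∘_)

  module _ {a} {A : Set a} where

    ∈-delete : ∀ {z x : A} as bs → z ∈ as ++ x ∷ bs → z ≢ x → z ∈ as ++ bs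
    ∈-delete []       bs (here z≡x)  z≢x = ⊥-elim (z≢x z≡x)
    ∈-delete []       bs (there z∈)  _   = z∈
    ∈-delete (_ ∷ as) bs (here z≡a)  _   = here z≡a
    ∈-delete (_ ∷ as) bs (there z∈)  z≢x = there (∈-delete as bs z∈ z≢x)

    unique-⊆⇒length-≤ : ∀ {xs ys : List A} → Unique xs → (∀ {z} → z ∈ xs → z ∈ ys) →
                        length xs ≤ length ys
    unique-⊆⇒length-≤ {[]}     _           _   = z≤n
    unique-⊆⇒length-≤ {x ∷ xs} (x∉xs ∷ xs!) xs⊆ys with ∈-∃++ (xs⊆ys (here refl))
    ... | as , bs , refl =
      subst (suc (length xs) ≤_) (sym (length-++-sucʳ as x bs))
        (s≤s (unique-⊆⇒length-≤ xs! (λ z∈xs → ∈-delete as bs (xs⊆ys (there z∈xs))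
          (λ z≡x → All.lookup x∉xs z∈xs (sym z≡x)))))

    unique-constant⇒length-≤1 : ∀ {xs : List A} → Unique xs →
                                (∀ {x y} → x ∈ xs → y ∈ xs → x ≡ y) → length xs ≤ 1
    unique-constant⇒length-≤1 {[]}          _                 _  = z≤n
    unique-constant⇒length-≤1 {_ ∷ []}      _                 _  = s≤s z≤n
    unique-constant⇒length-≤1 {_ ∷ _ ∷ _}   ((x≢y ∷ _) ∷ _) eq =
      ⊥-elim (x≢y (eq (here refl) (there (here refl))))

    all-delete : ∀ {p} {P : A → Set p} {x} as bs → All P (as ++ x ∷ bs) → All P (as ++ bs)
    all-delete []       bs (_ ∷ pbs)   = pbs
    all-delete (_ ∷ as) bs (pa ∷ rest) = pa ∷ all-delete as bs rest

    unique-delete : ∀ {x : A} as bs → Unique (as ++ x ∷ bs) → Unique (as ++ bs) × x ∉ as ++ bs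
    unique-delete []       bs (x∉bs ∷ bs!) = bs! , λ x∈bs → All.lookup x∉bs x∈bs refl
    unique-delete {x} (a ∷ as) bs (a∉rest ∷ rest!) with unique-delete as bs rest!
    ... | rest′! , x∉rest′ = all-delete as bs a∉rest ∷ rest′! , x∉a∷rest′
      where
      x∈as++x∷bs : ∀ as → x ∈ as ++ x ∷ bs
      x∈as++x∷bs []       = here refl
      x∈as++x∷bs (_ ∷ as) = there (x∈as++x∷bs as)
      x∉a∷rest′ : x ∉ a ∷ as ++ bs
      x∉a∷rest′ (here x≡a)  = All.lookup a∉rest (x∈as++x∷bs as) (sym x≡a)
      x∉a∷rest′ (there x∈) = x∉rest′ x∈

  module _ {a b} {A : Set a} {B : Set b} where

    unique-map⁺ : ∀ {f : A → B} {xs} → Unique xs →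
                  (∀ {x y} → x ∈ xs → y ∈ xs → f x ≡ f y → x ≡ y) → Unique (map f xs)
    unique-map⁺ {xs = []}     _          _   = []
    unique-map⁺ {xs = x ∷ xs} (x∉xs ∷ xs!) inj =
      All.tabulate (λ fz∈ fx≡fz → let (w , w∈ , z≡fw) = ∈-map⁻ _ fz∈ in
         All.lookup x∉xs w∈ (inj (here refl) (there w∈) (trans fx≡fz z≡fw)))
      ∷ unique-map⁺ xs! (λ x∈ y∈ → inj (there x∈) (there y∈))

  module _ {a} {A : Set a} where

    sum-map-mono : ∀ {f g : A → ℕ} xs → (∀ {x} → x ∈ xs → f x ≤ g x) →
                   sum (map f xs) ≤ sum (map g xs)
    sum-map-mono []       _   = z≤n
    sum-map-mono (x ∷ xs) f≤g = +-mono-≤ (f≤g (here refl)) (sum-map-mono xs (f≤g ∘ there))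

    sum-map-+ : ∀ (f g : A → ℕ) xs →
                sum (map (λ x → f x + g x) xs) ≡ sum (map f xs) + sum (map g xs)
    sum-map-+ f g []       = refl
    sum-map-+ f g (x ∷ xs) rewrite sum-map-+ f g xs = +-interchange (f x) (g x) _ _
      where
      +-interchange : ∀ a b c d → a + b + (c + d) ≡ a + c + (b + d)
      +-interchange = solve-∀

    sum-map-suc : ∀ (f : A → ℕ) xs → sum (map (λ x → suc (f x)) xs) ≡ sum (map f xs) + length xs
    sum-map-suc f []       = refl
    sum-map-suc f (x ∷ xs) rewrite sum-map-suc f xs = step (f x) (sum (map f xs)) (length xs)
      where
      step : ∀ a s l → suc (a + (s + l)) ≡ a + s + suc l
      step = solve-∀

    sum-map-delete : ∀ (f : A → ℕ) {x} as bs → sum (map f (as ++ x ∷ bs)) ≡ f x + sum (map f (as ++ bs))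
    sum-map-delete f []       bs = refl
    sum-map-delete f {x} (a ∷ as) bs = trans (cong (f a +_) (sum-map-delete f as bs)) (swap (f a) (f x) _)
      where
      swap : ∀ a b c → a + (b + c) ≡ b + (a + c)
      swap = solve-∀

    sum-map-zero : ∀ (xs : List A) → sum (map (λ _ → 0) xs) ≡ 0
    sum-map-zero []       = refl
    sum-map-zero (_ ∷ xs) = sum-map-zero xs

    module _ {p} {P : Pred A p} (P? : Decidable P) where

      indicator : A → ℕ
      indicator x = length (filter P? (x ∷ []))

      length-filter-∷ : ∀ x xs → length (filter P? (x ∷ xs)) ≡ indicator x + length (filter P? xs)
      length-filter-∷ x xs with P? x
      ... | yes _ = refl
      ... | no  _ = refl

      sum-indicator : ∀ xs → sum (map indicator xs) ≡ length (filter P? xs)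
      sum-indicator []       = refl
      sum-indicator (x ∷ xs) = trans (cong (indicator x +_) (sum-indicator xs))
                                     (sym (length-filter-∷ x xs))

      sum-filter-split : ∀ (f : A → ℕ) xs →
        sum (map f xs) ≡ sum (map f (filter P? xs)) + sum (map f (filter (¬? ∘ P?) xs))
      sum-filter-split f []       = refl
      sum-filter-split f (x ∷ xs) with P? x
      ... | yes _ = trans (cong (f x +_) (sum-filter-split f xs)) (sym (+-assoc (f x) _ _))
      ... | no  _ = trans (cong (f x +_) (sum-filter-split f xs))
                          (swap (f x) (sum (map f (filter P? xs))) (sum (map f (filter (¬? ∘ P?) xs))))
        where
        swap : ∀ a b c → a + (b + c) ≡ b + (a + c)
        swap = solve-∀

      length-filter-split : ∀ xs → length xs ≡ length (filter P? xs) + length (filter (¬? ∘ P?) xs)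
      length-filter-split []       = refl
      length-filter-split (x ∷ xs) with P? x
      ... | yes _ = cong suc (length-filter-split xs)
      ... | no  _ = trans (cong suc (length-filter-split xs)) (sym (+-suc _ _))

    module _ {p q} {P : Pred A p} {Q : Pred A q} (P? : Decidable P) (Q? : Decidable Q) where

      length-filter-mono : ∀ xs → (∀ {x} → x ∈ xs → P x → Q x) →
                           length (filter P? xs) ≤ length (filter Q? xs)
      length-filter-mono []       _   = z≤n
      length-filter-mono (x ∷ xs) P⇒Q with P? x | Q? x
      ... | yes _  | yes _  = s≤s (length-filter-mono xs (P⇒Q ∘ there))
      ... | yes px | no ¬qx = ⊥-elim (¬qx (P⇒Q (here refl) px))
      ... | no _   | yes _  = m≤n⇒m≤1+n (length-filter-mono xs (P⇒Q ∘ there))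
      ... | no _   | no _   = length-filter-mono xs (P⇒Q ∘ there)

  module _ {a b p q} {A : Set a} {B : Set b} {P : Pred A p} {Q : Pred B q}
           (P? : Decidable P) (Q? : Decidable Q) where

    indicator-mono : ∀ x y → (P x → Q y) → indicator P? x ≤ indicator Q? y
    indicator-mono x y P⇒Q with P? x | Q? y
    ... | yes _  | yes _  = ≤-refl
    ... | yes px | no ¬qy = ⊥-elim (¬qy (P⇒Q px))
    ... | no _   | _      = z≤n

  module _ {a b r} {A : Set a} {B : Set b} {R : A → B → Set r}
           (R? : ∀ x y → Dec (R x y)) where

    private
      count-∷ : ∀ x xs y → length (filter (λ x′ → R? x′ y) (x ∷ xs)) ≡
                           indicator (R? x) y + length (filter (λ x′ → R? x′ y) xs)
      count-∷ x xs y with R? x y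
      ... | yes _ = refl
      ... | no  _ = refl

    double-count : ∀ xs ys →
      sum (map (λ x → length (filter (R? x) ys)) xs) ≡
      sum (map (λ y → length (filter (λ x → R? x y) xs)) ys)
    double-count []       ys = sym (sum-map-zero ys)
    double-count (x ∷ xs) ys = begin
      length (filter (R? x) ys) + sum (map (λ x → length (filter (R? x) ys)) xs)
        ≡⟨ cong₂ _+_ (sym (sum-indicator (R? x) ys)) (double-count xs ys) ⟩
      sum (map (indicator (R? x)) ys) + sum (map (λ y → length (filter (λ x → R? x y) xs)) ys)
        ≡⟨ sym (sum-map-+ (indicator (R? x)) _ ys) ⟩
      sum (map (λ y → indicator (R? x) y + length (filter (λ x → R? x y) xs)) ys)
        ≡⟨ cong sum (map-cong (λ y → sym (count-∷ x xs y)) ys) ⟩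
      sum (map (λ y → length (filter (λ x → R? x y) (x ∷ xs))) ys) ∎
      where open ≡-Reasoning

module TotalBits where

  open import Data.Nat using (ℕ; zero; suc; _+_; _≤_; _<_; z≤n; s≤s; ⌊_/2⌋)
  open import Data.Nat.Properties
  open import Data.Sum using (inj₁; inj₂)
  open import Relation.Nullary using (yes; no)
  open import Data.Empty using (⊥-elim)
  open import Relation.Binary.PropositionalEquality using (_≡_; refl; sym; cong; cong₂; subst; subst₂; module ≡-Reasoning)
  open import Data.Nat.Tactic.RingSolver using (solve-∀)

  lowBit : ℕ → ℕ
  lowBit zero          = 0
  lowBit (suc zero)    = 1
  lowBit (suc (suc n)) = lowBit n

  onesWithin : ℕ → ℕ → ℕ
  onesWithin zero    k = 0
  onesWithin (suc f) k = lowBit k + onesWithin f ⌊ k /2⌋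

  -- Number of ones in the binary expansion of k (k has at most k digits).
  popcount : ℕ → ℕ
  popcount k = onesWithin k k

  onesWithin-zero : ∀ f → onesWithin f 0 ≡ 0
  onesWithin-zero zero    = refl
  onesWithin-zero (suc f) = onesWithin-zero f

  onesWithin-enough : ∀ f g k → k ≤ f → k ≤ g → onesWithin f k ≡ onesWithin g k
  onesWithin-enough zero    g       zero _   _   = sym (onesWithin-zero g)
  onesWithin-enough (suc f) zero    zero _   _   = onesWithin-zero (suc f)
  onesWithin-enough (suc f) (suc g) k    k≤f k≤g =
    cong (lowBit k +_) (onesWithin-enough f g ⌊ k /2⌋ (half-≤ k≤f) (half-≤ k≤g))
    where
    half-≤ : ∀ {k f} → k ≤ suc f → ⌊ k /2⌋ ≤ f
    half-≤ {zero}  _         = z≤n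
    half-≤ {suc k} (s≤s k≤f) = ≤-trans (≤-pred (⌊n/2⌋<n k)) k≤f

  lowBit-even : ∀ x → lowBit (x + x) ≡ 0
  lowBit-even zero    = refl
  lowBit-even (suc x) rewrite +-suc x x = lowBit-even x

  lowBit-odd : ∀ x → lowBit (suc (x + x)) ≡ 1
  lowBit-odd zero    = refl
  lowBit-odd (suc x) rewrite +-suc x x = lowBit-odd x

  popcount-even : ∀ x → popcount (x + x) ≡ popcount x
  popcount-even x = begin
    onesWithin (x + x) (x + x)        ≡⟨ onesWithin-enough _ _ (x + x) ≤-refl (n≤1+n _) ⟩
    onesWithin (suc (x + x)) (x + x)  ≡⟨ cong₂ _+_ (lowBit-even x) (cong (onesWithin (x + x)) (sym (n≡⌊n+n/2⌋ x))) ⟩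
    onesWithin (x + x) x              ≡⟨ onesWithin-enough _ _ x (m≤m+n x x) ≤-refl ⟩
    onesWithin x x                    ∎
    where open ≡-Reasoning

  popcount-odd : ∀ x → popcount (suc (x + x)) ≡ suc (popcount x)
  popcount-odd x = begin
    onesWithin (suc (x + x)) (suc (x + x))  ≡⟨ cong₂ _+_ (lowBit-odd x) (cong (onesWithin (x + x)) (sym (n≡⌈n+n/2⌉ x))) ⟩
    suc (onesWithin (x + x) x)              ≡⟨ cong suc (onesWithin-enough _ _ x (m≤m+n x x) ≤-refl) ⟩
    suc (onesWithin x x)                    ∎
    where open ≡-Reasoning

  -- totalBits m = h(m) = Σ_{k<m} popcount k, the number of ones written when
  -- listing 0, 1, …, m-1 in binary.
  totalBits : ℕ → ℕ
  totalBits zero    = 0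
  totalBits (suc m) = totalBits m + popcount m

  -- The two recurrences obtained by splitting 0 … m-1 into even and odd numbers.
  totalBits-even : ∀ x → totalBits (x + x) ≡ totalBits x + totalBits x + x
  totalBits-even zero    = refl
  totalBits-even (suc x) rewrite +-suc x x | totalBits-even x | popcount-even x | popcount-odd x =
    rearrange (totalBits x) x (popcount x)
    where
    rearrange : ∀ t x p → t + t + x + p + suc p ≡ t + p + (t + p) + suc x
    rearrange = solve-∀

  totalBits-odd : ∀ x → totalBits (suc (x + x)) ≡ totalBits x + totalBits (suc x) + x
  totalBits-odd x rewrite totalBits-even x | popcount-even x = rearrange (totalBits x) x (popcount x)
    where
    rearrange : ∀ t x p → t + t + x + p ≡ t + (t + p) + x
    rearrange = solve-∀

  data EvenOdd : ℕ → Set where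
    even : ∀ x → EvenOdd (x + x)
    odd  : ∀ x → EvenOdd (suc (x + x))

  evenOdd : ∀ n → EvenOdd n
  evenOdd zero = even zero
  evenOdd (suc n) with evenOdd n
  ... | even x = odd x
  ... | odd x  = subst EvenOdd (cong suc (+-suc x x)) (even (suc x))

  double-≤⇒≤ : ∀ {x y} → x + x ≤ suc (y + y) → x ≤ y
  double-≤⇒≤ {x} {y} le with x ≤? y
  ... | yes x≤y = x≤y
  ... | no  x≰y = ⊥-elim (<⇒≱ (subst (_≤ x + x) (cong suc (+-suc y y)) (+-mono-≤ y<x y<x)) le)
    where
    y<x : y < x
    y<x = ≰⇒> x≰y

  double-<⇒< : ∀ {x y} → x + x < y + y → x < y
  double-<⇒< {x} {y} lt with x <? y
  ... | yes x<y = x<y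
  ... | no  x≮y = ⊥-elim (<⇒≱ lt (+-mono-≤ (≮⇒≥ x≮y) (≮⇒≥ x≮y)))

  SuperadditiveBelow : ℕ → Set
  SuperadditiveBelow s = ∀ a b c → a + b < s → c ≤ a → c ≤ b →
                         totalBits a + totalBits b + c ≤ totalBits (a + b)

  private
    T : ℕ → ℕ
    T = totalBits

    <-by : ∀ u w {s} → 1 ≤ w → u + w ≡ s → u < s
    <-by u w pos refl = m<m+n u pos

    -- The four parity cases of the superadditivity step, for a ≤ b and c = a.
    -- Each unfolds both sides with the recurrences and applies the induction
    -- hypothesis to two pairs of roughly halved arguments.
    superadditive-even-even : ∀ x y → 1 ≤ x + y → x ≤ y → SuperadditiveBelow (x + x + (y + y)) →
                              T (x + x) + T (y + y) + (x + x) ≤ T (x + x + (y + y))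
    superadditive-even-even x y pos x≤y ih = begin
      T (x + x) + T (y + y) + (x + x)              ≡⟨ cong₂ (λ u v → u + v + (x + x)) (totalBits-even x) (totalBits-even y) ⟩
      (T x + T x + x) + (T y + T y + y) + (x + x)  ≡⟨ regroup (T x) (T y) x y ⟩
      (T x + T y + x) + (T x + T y + x) + (x + y)  ≤⟨ +-monoˡ-≤ (x + y) (+-mono-≤ hyp hyp) ⟩
      T (x + y) + T (x + y) + (x + y)              ≡⟨ sym (totalBits-even (x + y)) ⟩
      T ((x + y) + (x + y))                        ≡⟨ cong T (sym (double-sum x y)) ⟩
      T (x + x + (y + y))                          ∎
      where
      open ≤-Reasoning
      regroup : ∀ tx ty x y → tx + tx + x + (ty + ty + y) + (x + x) ≡ tx + ty + x + (tx + ty + x) + (x + y)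
      regroup = solve-∀
      double-sum : ∀ x y → x + x + (y + y) ≡ (x + y) + (x + y)
      double-sum = solve-∀
      hyp : T x + T y + x ≤ T (x + y)
      hyp = ih x y x (<-by (x + y) (x + y) pos (sym (double-sum x y))) ≤-refl x≤y

    superadditive-even-odd : ∀ x y → 1 ≤ x + y → x ≤ y → SuperadditiveBelow (x + x + suc (y + y)) →
                             T (x + x) + T (suc (y + y)) + (x + x) ≤ T (x + x + suc (y + y))
    superadditive-even-odd x y pos x≤y ih = begin
      T (x + x) + T (suc (y + y)) + (x + x)                ≡⟨ cong₂ (λ u v → u + v + (x + x)) (totalBits-even x) (totalBits-odd y) ⟩
      (T x + T x + x) + (T y + T (suc y) + y) + (x + x)    ≡⟨ regroup (T x) (T y) (T (suc y)) x y ⟩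
      (T x + T y + x) + (T x + T (suc y) + x) + (x + y)    ≤⟨ +-monoˡ-≤ (x + y) (+-mono-≤ hyp₁ hyp₂) ⟩
      T (x + y) + T (suc (x + y)) + (x + y)                ≡⟨ sym (totalBits-odd (x + y)) ⟩
      T (suc ((x + y) + (x + y)))                          ≡⟨ cong T (sym (double-sum x y)) ⟩
      T (x + x + suc (y + y))                              ∎
      where
      open ≤-Reasoning
      regroup : ∀ tx ty tsy x y → tx + tx + x + (ty + tsy + y) + (x + x) ≡ tx + ty + x + (tx + tsy + x) + (x + y)
      regroup = solve-∀
      double-sum : ∀ x y → x + x + suc (y + y) ≡ suc ((x + y) + (x + y))
      double-sum = solve-∀
      sum₂ : ∀ x y → x + suc y + (x + y) ≡ x + x + suc (y + y)
      sum₂ = solve-∀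
      hyp₂ : T x + T (suc y) + x ≤ T (suc (x + y))
      hyp₂ = subst (λ t → T x + T (suc y) + x ≤ T t) (+-suc x y)
               (ih x (suc y) x (<-by (x + suc y) (x + y) pos (sum₂ x y)) ≤-refl (m≤n⇒m≤1+n x≤y))
      hyp₁ : T x + T y + x ≤ T (x + y)
      hyp₁ = ih x y x (<-trans (+-monoʳ-< x (n<1+n y)) (<-by (x + suc y) (x + y) pos (sum₂ x y))) ≤-refl x≤y

    superadditive-odd-even : ∀ x y → suc x ≤ y → SuperadditiveBelow (suc (x + x) + (y + y)) →
                             T (suc (x + x)) + T (y + y) + suc (x + x) ≤ T (suc (x + x) + (y + y))
    superadditive-odd-even x y x<y ih = begin
      T (suc (x + x)) + T (y + y) + suc (x + x)            ≡⟨ cong₂ (λ u v → u + v + suc (x + x)) (totalBits-odd x) (totalBits-even y) ⟩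
      (T x + T (suc x) + x) + (T y + T y + y) + suc (x + x) ≡⟨ regroup (T x) (T (suc x)) (T y) x y ⟩
      (T x + T y + x) + (T (suc x) + T y + suc x) + (x + y) ≤⟨ +-monoˡ-≤ (x + y) (+-mono-≤ hyp₁ hyp₂) ⟩
      T (x + y) + T (suc (x + y)) + (x + y)                ≡⟨ sym (totalBits-odd (x + y)) ⟩
      T (suc ((x + y) + (x + y)))                          ≡⟨ cong T (sym (double-sum x y)) ⟩
      T (suc (x + x) + (y + y))                            ∎
      where
      open ≤-Reasoning
      regroup : ∀ tx tsx ty x y → tx + tsx + x + (ty + ty + y) + suc (x + x) ≡ tx + ty + x + (tsx + ty + suc x) + (x + y)
      regroup = solve-∀
      double-sum : ∀ x y → suc (x + x) + (y + y) ≡ suc ((x + y) + (x + y))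
      double-sum = solve-∀
      sum₂ : ∀ x y → suc x + y + (x + y) ≡ suc (x + x) + (y + y)
      sum₂ = solve-∀
      pos : 1 ≤ x + y
      pos = ≤-trans (s≤s z≤n) (≤-trans x<y (m≤n+m y x))
      hyp₂ : T (suc x) + T y + suc x ≤ T (suc x + y)
      hyp₂ = ih (suc x) y (suc x) (<-by (suc x + y) (x + y) pos (sum₂ x y)) ≤-refl x<y
      hyp₁ : T x + T y + x ≤ T (x + y)
      hyp₁ = ih x y x (<-trans (n<1+n (x + y)) (<-by (suc x + y) (x + y) pos (sum₂ x y))) ≤-refl (<⇒≤ x<y)

    superadditive-odd-odd : ∀ x y → x ≤ y → SuperadditiveBelow (suc (x + x) + suc (y + y)) →
                            T (suc (x + x)) + T (suc (y + y)) + suc (x + x) ≤ T (suc (x + x) + suc (y + y))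
    superadditive-odd-odd x y x≤y ih = begin
      T (suc (x + x)) + T (suc (y + y)) + suc (x + x)                ≡⟨ cong₂ (λ u v → u + v + suc (x + x)) (totalBits-odd x) (totalBits-odd y) ⟩
      (T x + T (suc x) + x) + (T y + T (suc y) + y) + suc (x + x)    ≡⟨ regroup (T x) (T (suc x)) (T y) (T (suc y)) x y ⟩
      (T x + T (suc y) + x) + (T (suc x) + T y + x) + suc (x + y)    ≤⟨ +-monoˡ-≤ (suc (x + y)) (+-mono-≤ hyp₁ hyp₂) ⟩
      T (suc (x + y)) + T (suc (x + y)) + suc (x + y)                ≡⟨ sym (totalBits-even (suc (x + y))) ⟩
      T (suc (x + y) + suc (x + y))                                  ≡⟨ cong T (sym (double-sum x y)) ⟩
      T (suc (x + x) + suc (y + y))                                  ∎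
      where
      open ≤-Reasoning
      regroup : ∀ tx tsx ty tsy x y → tx + tsx + x + (ty + tsy + y) + suc (x + x) ≡ tx + tsy + x + (tsx + ty + x) + suc (x + y)
      regroup = solve-∀
      double-sum : ∀ x y → suc (x + x) + suc (y + y) ≡ suc (x + y) + suc (x + y)
      double-sum = solve-∀
      sum-lt : suc (x + y) < suc (x + x) + suc (y + y)
      sum-lt = <-by (suc (x + y)) (suc (x + y)) (s≤s z≤n) (sym (double-sum x y))
      hyp₁ : T x + T (suc y) + x ≤ T (suc (x + y))
      hyp₁ = subst (λ t → T x + T (suc y) + x ≤ T t) (+-suc x y)
               (ih x (suc y) x (subst (_< suc (x + x) + suc (y + y)) (sym (+-suc x y)) sum-lt) ≤-refl (m≤n⇒m≤1+n x≤y))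
      hyp₂ : T (suc x) + T y + x ≤ T (suc x + y)
      hyp₂ = ih (suc x) y x sum-lt (n≤1+n x) x≤y

    superadditive-step : ∀ a b → a ≤ b → SuperadditiveBelow (a + b) → T a + T b + a ≤ T (a + b)
    superadditive-step a b a≤b ih with evenOdd a | evenOdd b
    ... | even zero    | _            = ≤-reflexive (+-identityʳ (T b))
    ... | even (suc x) | even y       = superadditive-even-even (suc x) y (s≤s z≤n) (double-≤⇒≤ (m≤n⇒m≤1+n a≤b)) ih
    ... | even (suc x) | odd y        = superadditive-even-odd (suc x) y (s≤s z≤n) (double-≤⇒≤ a≤b) ih
    ... | odd x        | even zero    = ⊥-elim (<⇒≱ (s≤s z≤n) a≤b)
    ... | odd x        | even (suc y) = superadditive-odd-even x (suc y) (double-<⇒< a≤b) ih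
    ... | odd x        | odd y        = superadditive-odd-odd x y (double-≤⇒≤ (m≤n⇒m≤1+n (≤-pred a≤b))) ih

    -- The general step follows from the case a ≤ b by symmetry and monotonicity in c.
    superadditive-from-step : ∀ a b c → SuperadditiveBelow (a + b) → c ≤ a → c ≤ b →
                              T a + T b + c ≤ T (a + b)
    superadditive-from-step a b c ih c≤a c≤b with ≤-total a b
    ... | inj₁ a≤b = ≤-trans (+-monoʳ-≤ (T a + T b) c≤a) (superadditive-step a b a≤b ih)
    ... | inj₂ b≤a = subst₂ _≤_ (cong (_+ c) (+-comm (T b) (T a))) (cong T (+-comm b a))
                       (≤-trans (+-monoʳ-≤ (T b + T a) c≤b)
                         (superadditive-step b a b≤a (subst SuperadditiveBelow (+-comm a b) ih)))

    superadditive-below : ∀ s → SuperadditiveBelow s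
    superadditive-below (suc s) a b c (s≤s a+b≤s) c≤a c≤b with m≤n⇒m<n∨m≡n a+b≤s
    ... | inj₁ a+b<s = superadditive-below s a b c a+b<s c≤a c≤b
    ... | inj₂ a+b≡s = superadditive-from-step a b c
                         (subst SuperadditiveBelow (sym a+b≡s) (superadditive-below s)) c≤a c≤b

  totalBits-superadditive : ∀ a b c → c ≤ a → c ≤ b → totalBits a + totalBits b + c ≤ totalBits (a + b)
  totalBits-superadditive a b c = superadditive-below (suc (a + b)) a b c ≤-refl

module FinSets where

  open import Data.Nat using (ℕ; suc; _≤_; _<_)
  open import Data.Nat.Properties
  open import Data.List using (List; []; _∷_; filter)
  open import Data.List.Properties using (filter-accept; filter-reject; filter-all; ≡-dec)
  open import Data.List.Relation.Unary.All using (All; []; _∷_)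
  import Data.List.Relation.Unary.All as All
  import Data.List.Relation.Unary.All.Properties as AllProp
  open import Data.List.Relation.Unary.Any using (here; there)
  open import Data.List.Relation.Unary.AllPairs using (AllPairs; []; _∷_)
  import Data.List.Relation.Unary.AllPairs as AllPairs
  import Data.List.Relation.Unary.AllPairs.Properties as AllPairsProp
  open import Data.List.Relation.Unary.Linked.Properties using (Linked⇒AllPairs; AllPairs⇒Linked)
  open import Data.List.Relation.Unary.Unique.Propositional using (Unique)
  open import Data.List.Membership.Propositional using (_∈_; _∉_)
  open import Data.List.Membership.Propositional.Properties using (∈-filter⁺; ∈-filter⁻)
  open import Data.Product using (_×_; _,_)
  open import Data.Sum using (_⊎_; inj₁; inj₂)
  open import Data.Empty using (⊥-elim)
  open import Relation.Nullary using (Dec; yes; no; ¬?)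
  import Data.List.Membership.DecPropositional as SetMembership
  open import Relation.Binary.PropositionalEquality using (_≡_; _≢_; refl; sym; trans; cong; subst)
  open import Function using (_∘_)
  open import Defs

  -- Strictly decreasing lists; Defs states this with Linked, which is
  -- equivalent (by transitivity) to the more convenient AllPairs form.
  Decreasing : List ℕ → Set
  Decreasing = AllPairs (λ a b → b < a)

  finSet⇒decreasing : ∀ {X} → IsFinSetPos X → Decreasing X
  finSet⇒decreasing (_ , linked) = Linked⇒AllPairs (λ b<a c<b → <-trans c<b b<a) linked

  decreasing⇒finSet : ∀ {X} → All (1 ≤_) X → Decreasing X → IsFinSetPos X
  decreasing⇒finSet pos dec = pos , AllPairs⇒Linked dec

  Canonical : List ℕ → Set
  Canonical X = All (1 ≤_) X × Decreasing X

  finSet⇒canonical : ∀ {X} → IsFinSetPos X → Canonical X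
  finSet⇒canonical fs@(pos , _) = pos , finSet⇒decreasing fs

  canonical⇒finSet : ∀ {X} → Canonical X → IsFinSetPos X
  canonical⇒finSet (pos , dec) = decreasing⇒finSet pos dec

  canonical-tail : ∀ {a A} → Canonical (a ∷ A) → Canonical A
  canonical-tail (_ ∷ pos , _ ∷ dec) = pos , dec

  inPow⇒decreasing : ∀ {n X} → InPow n X → Decreasing X
  inPow⇒decreasing (fs , _) = finSet⇒decreasing fs

  decreasing⇒unique : ∀ {X} → Decreasing X → Unique X
  decreasing⇒unique = AllPairs.map (λ b<a a≡b → <-irrefl (sym a≡b) b<a)

  ∈⇒≤head : ∀ {a A y} → Decreasing (a ∷ A) → y ∈ a ∷ A → y ≤ a
  ∈⇒≤head _             (here refl) = ≤-refl
  ∈⇒≤head (below-a ∷ _) (there y∈A) = <⇒≤ (All.lookup below-a y∈A)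

  >head⇒∉ : ∀ {a A y} → Decreasing (a ∷ A) → a < y → y ∉ a ∷ A
  >head⇒∉ dec a<y y∈ = <⇒≱ a<y (∈⇒≤head dec y∈)

  head∉tail : ∀ {a A} → Decreasing (a ∷ A) → a ∉ A
  head∉tail (below-a ∷ _) a∈A = <-irrefl refl (All.lookup below-a a∈A)

  decreasing-ext : ∀ A B → Decreasing A → Decreasing B →
                   (∀ {x} → x ∈ A → x ∈ B) → (∀ {x} → x ∈ B → x ∈ A) → A ≡ B
  decreasing-ext []      []      _    _    _   _   = refl
  decreasing-ext []      (b ∷ B) _    _    _   B⊆A with () ← B⊆A (here refl)
  decreasing-ext (a ∷ A) []      _    _    A⊆B _   with () ← A⊆B (here refl)
  decreasing-ext (a ∷ A) (b ∷ B) decA decB A⊆B B⊆A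
    with ≤-antisym (∈⇒≤head decB (A⊆B (here refl))) (∈⇒≤head decA (B⊆A (here refl)))
  ... | refl = cong (a ∷_) (decreasing-ext A B (AllPairs.tail decA) (AllPairs.tail decB)
                              (tail⊆ decA A⊆B) (tail⊆ decB B⊆A))
    where
    tail⊆ : ∀ {C D} → Decreasing (a ∷ C) → (∀ {x} → x ∈ a ∷ C → x ∈ a ∷ D) → ∀ {x} → x ∈ C → x ∈ D
    tail⊆ decC C⊆D x∈C with C⊆D (there x∈C)
    ... | here refl = ⊥-elim (head∉tail decC x∈C)
    ... | there x∈D = x∈D

  remove : ℕ → List ℕ → List ℕ
  remove j = filter (λ y → ¬? (y ≟ j))

  ∈-remove⁻ : ∀ {j X y} → y ∈ remove j X → y ∈ X × y ≢ j
  ∈-remove⁻ {j} = ∈-filter⁻ (λ y → ¬? (y ≟ j))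

  ∈-remove⁺ : ∀ {j X y} → y ∈ X → y ≢ j → y ∈ remove j X
  ∈-remove⁺ {j} = ∈-filter⁺ (λ y → ¬? (y ≟ j))

  remove-inPow : ∀ {n j X} → InPow n X → InPow n (remove j X)
  remove-inPow {j = j} (fs@(pos , _) , bound) =
    decreasing⇒finSet (AllProp.filter⁺ keep? pos) (AllPairsProp.filter⁺ keep? (finSet⇒decreasing fs)) ,
    AllProp.filter⁺ keep? bound
    where
    keep? : ∀ y → Dec (y ≢ j)
    keep? y = ¬? (y ≟ j)

  remove-head : ∀ s B → Decreasing (s ∷ B) → remove s (s ∷ B) ≡ B
  remove-head s B (below-s ∷ _) =
    trans (filter-reject (λ y → ¬? (y ≟ s)) (λ s≢s → s≢s refl))
          (filter-all (λ y → ¬? (y ≟ s)) (All.map (λ b<s b≡s → <-irrefl b≡s b<s) below-s))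

  remove-∷ : ∀ j s B → j ≢ s → remove j (s ∷ B) ≡ s ∷ remove j B
  remove-∷ j s B j≢s = filter-accept (λ y → ¬? (y ≟ j)) (λ s≡j → j≢s (sym s≡j))

  insert : ℕ → List ℕ → List ℕ
  insert j []       = j ∷ []
  insert j (x ∷ xs) with x <? j
  ... | yes _ = j ∷ x ∷ xs
  ... | no  _ = x ∷ insert j xs

  ∈-insert⁻ : ∀ {y} j X → y ∈ insert j X → y ≡ j ⊎ y ∈ X
  ∈-insert⁻ j []       (here y≡j) = inj₁ y≡j
  ∈-insert⁻ j (x ∷ xs) y∈ with x <? j
  ∈-insert⁻ j (x ∷ xs) (here y≡j)  | yes _ = inj₁ y≡j
  ∈-insert⁻ j (x ∷ xs) (there y∈) | yes _ = inj₂ y∈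
  ∈-insert⁻ j (x ∷ xs) (here y≡x)  | no  _ = inj₂ (here y≡x)
  ∈-insert⁻ j (x ∷ xs) (there y∈) | no  _ with ∈-insert⁻ j xs y∈
  ... | inj₁ y≡j  = inj₁ y≡j
  ... | inj₂ y∈xs = inj₂ (there y∈xs)

  ∈-insert-new : ∀ j X → j ∈ insert j X
  ∈-insert-new j []       = here refl
  ∈-insert-new j (x ∷ xs) with x <? j
  ... | yes _ = here refl
  ... | no  _ = there (∈-insert-new j xs)

  ∈-insert-old : ∀ {y} j X → y ∈ X → y ∈ insert j X
  ∈-insert-old j (x ∷ xs) y∈ with x <? j
  ... | yes _ = there y∈
  ∈-insert-old j (x ∷ xs) (here y≡x)  | no _ = here y≡x
  ∈-insert-old j (x ∷ xs) (there y∈) | no _ = there (∈-insert-old j xs y∈)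

  insert-decreasing : ∀ j X → Decreasing X → j ∉ X → Decreasing (insert j X)
  insert-decreasing j []       _                    _   = [] ∷ []
  insert-decreasing j (x ∷ xs) dec@(below-x ∷ decxs) j∉ with x <? j
  ... | yes x<j = (x<j ∷ All.map (λ y<x → <-trans y<x x<j) below-x) ∷ dec
  ... | no  x≮j = All.tabulate (λ y∈ → below (∈-insert⁻ j xs y∈)) ∷ insert-decreasing j xs decxs (j∉ ∘ there)
    where
    j<x : j < x
    j<x with m≤n⇒m<n∨m≡n (≮⇒≥ x≮j)
    ... | inj₁ j<x = j<x
    ... | inj₂ refl = ⊥-elim (j∉ (here refl))
    below : ∀ {y} → y ≡ j ⊎ y ∈ xs → y < x
    below (inj₁ refl) = j<x
    below (inj₂ y∈xs) = All.lookup below-x y∈xs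

  insert-inPow : ∀ {n j X} → 1 ≤ j → j ≤ n → InPow n X → j ∉ X → InPow n (insert j X)
  insert-inPow {n} {j} {X} 1≤j j≤n (fs@(pos , _) , bound) j∉X =
    decreasing⇒finSet (All.tabulate (λ y∈ → with-new 1≤j pos (∈-insert⁻ j X y∈)))
                      (insert-decreasing j X (finSet⇒decreasing fs) j∉X) ,
    All.tabulate (λ y∈ → with-new j≤n bound (∈-insert⁻ j X y∈))
    where
    with-new : ∀ {P : ℕ → Set} {y} → P j → All P X → y ≡ j ⊎ y ∈ X → P y
    with-new Pj _   (inj₁ refl) = Pj
    with-new _  all (inj₂ y∈X)  = All.lookup all y∈X

  insert-injective : ∀ j X Y → Decreasing X → Decreasing Y → j ∉ X → j ∉ Y →
                     insert j X ≡ insert j Y → X ≡ Y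
  insert-injective j X Y decX decY j∉X j∉Y eq =
    decreasing-ext X Y decX decY (⊆-from j∉X eq) (⊆-from j∉Y (sym eq))
    where
    ⊆-from : ∀ {X Y} → j ∉ X → insert j X ≡ insert j Y → ∀ {x} → x ∈ X → x ∈ Y
    ⊆-from {X} {Y} j∉X eq x∈X with ∈-insert⁻ j Y (subst (_ ∈_) eq (∈-insert-old j X x∈X))
    ... | inj₁ refl = ⊥-elim (j∉X x∈X)
    ... | inj₂ x∈Y  = x∈Y

  _∈ᶠ?_ : (X : List ℕ) (𝓕 : Family) → Dec (X ∈ 𝓕)
  X ∈ᶠ? 𝓕 = SetMembership._∈?_ (≡-dec _≟_) X 𝓕

  dropMax : List ℕ → List ℕ
  dropMax []      = []
  dropMax (_ ∷ X) = X

  max-head : ∀ {s X} → InPow s X → s ∈ X → X ≡ s ∷ dropMax X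
  max-head {s} {x ∷ X} (fs , x≤s ∷ _) s∈X with ≤-antisym x≤s (∈⇒≤head (finSet⇒decreasing fs) s∈X)
  ... | refl = refl

  inPow-dropMax : ∀ {N X} → InPow (suc N) X → InPow N (dropMax X)
  inPow-dropMax {X = []}    _ = decreasing⇒finSet [] [] , []
  inPow-dropMax {X = x ∷ X} (fs@(_ ∷ pos , _) , x≤1+N ∷ _) with finSet⇒decreasing fs
  ... | below-x ∷ dec = decreasing⇒finSet pos dec , All.map (λ y<x → ≤-pred (≤-trans y<x x≤1+N)) below-x

  inPow-shrink : ∀ {N X} → InPow (suc N) X → suc N ∉ X → InPow N X
  inPow-shrink {N} {X} (fs , bound) 1+N∉X = fs , All.tabulate below
    where
    below : ∀ {x} → x ∈ X → x ≤ N
    below x∈X with m≤n⇒m<n∨m≡n (All.lookup bound x∈X)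
    ... | inj₁ x<1+N = ≤-pred x<1+N
    ... | inj₂ refl  = ⊥-elim (1+N∉X x∈X)

module BinaryCode where

  open import Data.Nat using (ℕ; zero; suc; _+_; _^_; _∸_; _≤_; _<_; z≤n; s≤s; pred)
  open import Data.Nat.Properties
  open import Data.List using (List; []; _∷_; length)
  open import Data.List.Relation.Unary.All using (All; []; _∷_)
  import Data.List.Relation.Unary.All as All
  open import Data.List.Relation.Unary.Any using (here; there)
  open import Data.List.Relation.Unary.AllPairs using ([]; _∷_)
  open import Data.List.Membership.Propositional using (_∈_; _∉_)
  open import Data.Product using (Σ; _×_; _,_; proj₁; proj₂)
  open import Data.Empty using (⊥-elim)
  open import Relation.Nullary using (yes; no; contradiction)
  open import Relation.Binary.Definitions using (tri<; tri≈; tri>)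
  open import Relation.Binary.PropositionalEquality using (_≡_; refl; sym; trans; cong; subst; subst₂; module ≡-Reasoning)
  open import Data.Nat.Tactic.RingSolver using (solve-∀)
  open import Defs
  open FinSets
  open TotalBits

  -- The binary code of a finite set of positive integers: Σ_{x ∈ X} 2^(x-1).
  -- It is a bijection onto ℕ which turns the colex order into the usual order.
  code : List ℕ → ℕ
  code []      = 0
  code (x ∷ X) = 2 ^ pred x + code X

  2^-double : ∀ k → 2 ^ k + 2 ^ k ≡ 2 ^ suc k
  2^-double k = cong (2 ^ k +_) (sym (+-identityʳ (2 ^ k)))

  code-< : ∀ k X → Canonical X → All (_≤ k) X → code X < 2 ^ k
  code-< k []      _                              _            = m^n>0 2 k
  code-< k (suc x ∷ X) (_ ∷ pos , below-x ∷ dec) (x<k ∷ _) = begin-strict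
    2 ^ x + code X  <⟨ +-monoʳ-< (2 ^ x) (code-< x X (pos , dec) (All.map ≤-pred below-x)) ⟩
    2 ^ x + 2 ^ x   ≡⟨ 2^-double x ⟩
    2 ^ suc x       ≤⟨ ^-monoʳ-≤ 2 x<k ⟩
    2 ^ k           ∎
    where open ≤-Reasoning

  code-tail-< : ∀ {a A} → Canonical (a ∷ A) → code A < 2 ^ pred a
  code-tail-< {zero}          (() ∷ _ , _)
  code-tail-< {suc a} {A} can@(_ , below-a ∷ _) = code-< a A (canonical-tail can) (All.map ≤-pred below-a)

  head<⇒code< : ∀ {a A b} B → Canonical (a ∷ A) → a < b → code (a ∷ A) < code (b ∷ B)
  head<⇒code< {a} {A} {suc b} B can@(_ , below-a ∷ _) (s≤s a≤b) = begin-strict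
    code (a ∷ A)   <⟨ code-< a (a ∷ A) can (≤-refl ∷ All.map <⇒≤ below-a) ⟩
    2 ^ a          ≤⟨ ^-monoʳ-≤ 2 a≤b ⟩
    2 ^ b          ≤⟨ m≤m+n (2 ^ b) _ ⟩
    2 ^ b + _      ∎
    where open ≤-Reasoning

  code-nonempty : ∀ b B → 0 < code (b ∷ B)
  code-nonempty b B = <-≤-trans (m^n>0 2 (pred b)) (m≤m+n _ _)

  code-injective : ∀ A B → Canonical A → Canonical B → code A ≡ code B → A ≡ B
  code-injective []      []      _    _    _  = refl
  code-injective []      (b ∷ B) _    _    eq = contradiction eq (<⇒≢ (code-nonempty b B))
  code-injective (a ∷ A) []      _    _    eq = contradiction (sym eq) (<⇒≢ (code-nonempty a A))
  code-injective (a ∷ A) (b ∷ B) canA canB eq with <-cmp a b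
  ... | tri< a<b _ _ = contradiction eq (<⇒≢ (head<⇒code< B canA a<b))
  ... | tri> _ _ b<a = contradiction (sym eq) (<⇒≢ (head<⇒code< A canB b<a))
  ... | tri≈ _ refl _ = cong (a ∷_) (code-injective A B (canonical-tail canA) (canonical-tail canB)
                                       (+-cancelˡ-≡ (2 ^ pred a) _ _ eq))

  code<⇒colex : ∀ A B → Canonical A → Canonical B → code B < code A → B <colex A
  code<⇒colex []      B       _    _    ()
  code<⇒colex (a ∷ A) []      canA _    _ =
    a , here refl , (λ ()) , λ y a<y → (λ ()) , (λ y∈ → ⊥-elim (>head⇒∉ (proj₂ canA) a<y y∈))
  code<⇒colex (a ∷ A) (b ∷ B) canA canB lt with <-cmp a b
  ... | tri< a<b _ _ = contradiction lt (<⇒≯ (head<⇒code< B canA a<b))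
  ... | tri> _ _ b<a =
    a , here refl , (λ a∈ → <⇒≱ b<a (∈⇒≤head (proj₂ canB) a∈)) ,
    λ y a<y → (λ y∈ → ⊥-elim (>head⇒∉ (proj₂ canB) (<-trans b<a a<y) y∈)) ,
              (λ y∈ → ⊥-elim (>head⇒∉ (proj₂ canA) a<y y∈))
  ... | tri≈ _ refl _
    with code<⇒colex A B (canonical-tail canA) (canonical-tail canB) (+-cancelˡ-< (2 ^ pred a) _ _ lt)
  ...   | x , x∈A , x∉B , agree = x , there x∈A , x∉a∷B , agree′
    where
    x∉a∷B : x ∉ a ∷ B
    x∉a∷B (here refl)  = head∉tail (proj₂ canA) x∈A
    x∉a∷B (there x∈B) = x∉B x∈B
    agree′ : ∀ y → x < y → (y ∈ a ∷ B → y ∈ a ∷ A) × (y ∈ a ∷ A → y ∈ a ∷ B)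
    agree′ y x<y = B⇒A , A⇒B
      where
      B⇒A : y ∈ a ∷ B → y ∈ a ∷ A
      B⇒A (here y≡a) = here y≡a
      B⇒A (there y∈) = there (proj₁ (agree y x<y) y∈)
      A⇒B : y ∈ a ∷ A → y ∈ a ∷ B
      A⇒B (here y≡a) = here y≡a
      A⇒B (there y∈) = there (proj₂ (agree y x<y) y∈)

  decode : ∀ b k → k < 2 ^ b → Σ (List ℕ) λ B → Canonical B × All (_≤ b) B × code B ≡ k
  decode zero    zero    _          = [] , ([] , []) , [] , refl
  decode zero    (suc k) (s≤s ())
  decode (suc b) k       k<2^1+b with 2 ^ b ≤? k
  ... | no k≱2^b with decode b k (≰⇒> k≱2^b)
  ...   | B , can , bound , code≡k = B , can , All.map m≤n⇒m≤1+n bound , code≡k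
  decode (suc b) k k<2^1+b | yes 2^b≤k with decode b (k ∸ 2 ^ b) rest<2^b
    where
    rest<2^b : k ∸ 2 ^ b < 2 ^ b
    rest<2^b = +-cancelˡ-< (2 ^ b) _ _
      (subst₂ _<_ (sym (m+[n∸m]≡n 2^b≤k)) (sym (2^-double b)) k<2^1+b)
  ... | B , (pos , dec) , bound , code≡rest =
    suc b ∷ B , (s≤s z≤n ∷ pos , All.map s≤s bound ∷ dec) , ≤-refl ∷ All.map m≤n⇒m≤1+n bound ,
    trans (cong (2 ^ b +_) code≡rest) (m+[n∸m]≡n 2^b≤k)

  n<2^n : ∀ n → n < 2 ^ n
  n<2^n zero    = s≤s z≤n
  n<2^n (suc n) = begin-strict
    suc n          ≤⟨ n<2^n n ⟩
    2 ^ n          <⟨ m<m+n (2 ^ n) (m^n>0 2 n) ⟩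
    2 ^ n + 2 ^ n  ≡⟨ 2^-double n ⟩
    2 ^ suc n      ∎
    where open ≤-Reasoning

  fromCode : ℕ → List ℕ
  fromCode k = proj₁ (decode k k (n<2^n k))

  fromCode-canonical : ∀ k → Canonical (fromCode k)
  fromCode-canonical k = proj₁ (proj₂ (decode k k (n<2^n k)))

  code-fromCode : ∀ k → code (fromCode k) ≡ k
  code-fromCode k = proj₂ (proj₂ (proj₂ (decode k k (n<2^n k))))

  popcount-2^+ : ∀ j r → r < 2 ^ j → popcount (2 ^ j + r) ≡ suc (popcount r)
  popcount-2^+ zero    zero    _        = refl
  popcount-2^+ zero    (suc r) (s≤s ())
  popcount-2^+ (suc j) r       r<2^1+j with evenOdd r
  ... | even q = begin
    popcount (2 ^ suc j + (q + q))              ≡⟨ cong popcount (regroup (2 ^ j) q) ⟩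
    popcount ((2 ^ j + q) + (2 ^ j + q))        ≡⟨ popcount-even (2 ^ j + q) ⟩
    popcount (2 ^ j + q)                        ≡⟨ popcount-2^+ j q (double-<⇒< (subst (q + q <_) (sym (2^-double j)) r<2^1+j)) ⟩
    suc (popcount q)                            ≡⟨ cong suc (sym (popcount-even q)) ⟩
    suc (popcount (q + q))                      ∎
    where
    open ≡-Reasoning
    regroup : ∀ t q → t + (t + 0) + (q + q) ≡ (t + q) + (t + q)
    regroup = solve-∀
  ... | odd q = begin
    popcount (2 ^ suc j + suc (q + q))          ≡⟨ cong popcount (regroup (2 ^ j) q) ⟩
    popcount (suc ((2 ^ j + q) + (2 ^ j + q)))  ≡⟨ popcount-odd (2 ^ j + q) ⟩
    suc (popcount (2 ^ j + q))                  ≡⟨ cong suc (popcount-2^+ j q (double-<⇒< q+q<)) ⟩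
    suc (suc (popcount q))                      ≡⟨ cong suc (sym (popcount-odd q)) ⟩
    suc (popcount (suc (q + q)))                ∎
    where
    open ≡-Reasoning
    regroup : ∀ t q → t + (t + 0) + suc (q + q) ≡ suc ((t + q) + (t + q))
    regroup = solve-∀
    q+q< : q + q < 2 ^ j + 2 ^ j
    q+q< = <-trans (n<1+n (q + q)) (subst (suc (q + q) <_) (sym (2^-double j)) r<2^1+j)

  popcount-code : ∀ A → Canonical A → popcount (code A) ≡ length A
  popcount-code []      _   = refl
  popcount-code (a ∷ A) can =
    trans (popcount-2^+ (pred a) (code A) (code-tail-< can))
          (cong suc (popcount-code A (canonical-tail can)))

module InitialColex where

  open import Data.Nat using (zero; suc; _+_; _≤_; _<_; z≤n)
  open import Data.Nat.Properties
  open import Data.Nat.ListAction using (sum)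
  open import Data.List using (_∷_; _++_; length; map; upTo)
  open import Data.List.Properties using (length-map; length-upTo; length-++-sucʳ; map-∘; map-cong-local)
  open import Data.List.Relation.Unary.All using (All)
  import Data.List.Relation.Unary.All as All
  open import Data.List.Relation.Unary.Unique.Propositional using (Unique)
  import Data.List.Relation.Unary.Unique.Propositional.Properties as Unique
  open import Data.List.Membership.Propositional using (_∈_)
  open import Data.List.Membership.Propositional.Properties using (∈-∃++; ∈-map⁻; ∈-upTo⁺; ∈-upTo⁻)
  open import Data.List.Membership.DecPropositional _≟_ using (_∈?_)
  open import Data.Product using (_,_)
  open import Data.Sum using (inj₁; inj₂)
  open import Data.Empty using (⊥-elim)
  open import Relation.Nullary using (yes; no)
  open import Relation.Binary.PropositionalEquality using (_≡_; _≢_; refl; sym; trans; cong; subst)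
  open import Defs
  open Counting
  open FinSets
  open TotalBits
  open BinaryCode

  <suc-≢⇒< : ∀ {k m} → k < suc m → k ≢ m → k < m
  <suc-≢⇒< k<1+m k≢m with m≤n⇒m<n∨m≡n (≤-pred k<1+m)
  ... | inj₁ k<m = k<m
  ... | inj₂ k≡m = ⊥-elim (k≢m k≡m)

  -- A duplicate-free list of at least m numbers below m contains each of
  -- 0, …, m-1, so its total popcount is at least totalBits m.
  totalBits-≤-sum : ∀ m ks → Unique ks → All (_< m) ks → m ≤ length ks →
                    totalBits m ≤ sum (map popcount ks)
  totalBits-≤-sum zero    _  _   _     _   = z≤n
  totalBits-≤-sum (suc m) ks ks! below len with m ∈? ks
  ... | no m∉ks = ⊥-elim (<⇒≱ len (subst (length ks ≤_) (length-upTo m)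
                    (unique-⊆⇒length-≤ ks! (λ k∈ks → ∈-upTo⁺ (<suc-≢⇒< (All.lookup below k∈ks)
                                                              (λ { refl → m∉ks k∈ks }))))))
  ... | yes m∈ks with ∈-∃++ m∈ks
  ...   | as , bs , refl with unique-delete as bs ks!
  ...     | rest! , m∉rest = begin
    totalBits m + popcount m                    ≤⟨ +-monoˡ-≤ (popcount m) (totalBits-≤-sum m (as ++ bs) rest! below′ len′) ⟩
    sum (map popcount (as ++ bs)) + popcount m  ≡⟨ +-comm _ (popcount m) ⟩
    popcount m + sum (map popcount (as ++ bs))  ≡⟨ sym (sum-map-delete popcount as bs) ⟩
    sum (map popcount (as ++ m ∷ bs))           ∎
    where
    open ≤-Reasoning
    below′ : All (_< m) (as ++ bs)
    below′ = All.tabulate (λ k∈ → <suc-≢⇒< (All.lookup (all-delete as bs below) k∈)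
                                            (λ { refl → m∉rest k∈ }))
    len′ : m ≤ length (as ++ bs)
    len′ = ≤-pred (subst (suc m ≤_) (length-++-sucʳ as m bs) len)

  -- Every member of 𝓘(m) has code below m: the sets with smaller code are
  -- colex-smaller, hence also in 𝓘(m), and they are all distinct.
  initial-code-< : ∀ {𝓘 m} → IsInitialColex 𝓘 m → ∀ {A} → A ∈ 𝓘 → code A < m
  initial-code-< {𝓘} (finSets , _ , refl , closed) {A} A∈𝓘 =
    subst (_≤ length 𝓘) (trans (length-map fromCode (upTo (suc (code A)))) (length-upTo (suc (code A))))
      (unique-⊆⇒length-≤ below-A! below-A⊆𝓘)
    where
    canA : Canonical A
    canA = finSet⇒canonical (All.lookup finSets A∈𝓘)
    below-A : Family
    below-A = map fromCode (upTo (suc (code A)))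
    below-A! : Unique below-A
    below-A! = Unique.map⁺ (λ {k} {l} eq → trans (sym (code-fromCode k)) (trans (cong code eq) (code-fromCode l)))
                           (Unique.upTo⁺ (suc (code A)))
    below-A⊆𝓘 : ∀ {B} → B ∈ below-A → B ∈ 𝓘
    below-A⊆𝓘 B∈ with ∈-map⁻ fromCode B∈
    ... | k , k∈ , refl with m≤n⇒m<n∨m≡n (≤-pred (∈-upTo⁻ k∈))
    ...   | inj₁ k<codeA = closed A A∈𝓘 (fromCode k) (canonical⇒finSet (fromCode-canonical k))
              (code<⇒colex A (fromCode k) canA (fromCode-canonical k) (subst (_< code A) (sym (code-fromCode k)) k<codeA))
    ...   | inj₂ refl    = subst (_∈ 𝓘) (code-injective A _ canA (fromCode-canonical (code A)) (sym (code-fromCode (code A)))) A∈𝓘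

  -- ‖𝓘(m)‖ ≥ totalBits m: the codes of 𝓘(m) are m distinct numbers below m,
  -- and the size of a set is the popcount of its code.
  totalBits-≤-norm : ∀ {𝓘 m} → IsInitialColex 𝓘 m → totalBits m ≤ norm 𝓘
  totalBits-≤-norm {𝓘} {m} initial@(finSets , 𝓘! , len , _) =
    subst (totalBits m ≤_) popcounts≡norm
      (totalBits-≤-sum m (map code 𝓘) codes! codes<m (≤-reflexive (sym (trans (length-map code 𝓘) len))))
    where
    can : ∀ {A} → A ∈ 𝓘 → Canonical A
    can A∈ = finSet⇒canonical (All.lookup finSets A∈)
    codes! : Unique (map code 𝓘)
    codes! = unique-map⁺ 𝓘! (λ A∈ B∈ → code-injective _ _ (can A∈) (can B∈))
    codes<m : All (_< m) (map code 𝓘)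
    codes<m = All.tabulate (λ k∈ → let (A , A∈ , k≡) = ∈-map⁻ code k∈ in
                                    subst (_< m) (sym k≡) (initial-code-< initial A∈))
    popcounts≡norm : sum (map popcount (map code 𝓘)) ≡ norm 𝓘
    popcounts≡norm = cong sum (trans (sym (map-∘ 𝓘))
                       (map-cong-local (All.map (λ fs → popcount-code _ (finSet⇒canonical fs)) finSets)))

module Edges where

  open import Data.Nat using (ℕ; zero; suc; _+_; _≤_; z≤n)
  open import Data.Nat.Properties
  open import Data.Nat.ListAction using (sum)
  open import Data.List using (List; []; _∷_; length; filter; map)
  open import Data.List.Properties using (length-map; length-filter; map-∘)
  open import Data.List.Relation.Unary.All using (All; []; _∷_)
  open import Data.List.Relation.Unary.AllPairs using (_∷_)
  import Data.List.Relation.Unary.All as All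
  open import Data.List.Relation.Unary.Any using (here)
  open import Data.List.Relation.Unary.Unique.Propositional using (Unique)
  import Data.List.Relation.Unary.Unique.Propositional.Properties as Unique
  open import Data.List.Membership.Propositional using (_∈_; _∉_)
  open import Data.List.Membership.Propositional.Properties using (∈-filter⁺; ∈-filter⁻; ∈-map⁺; ∈-map⁻)
  open import Data.List.Membership.DecPropositional _≟_ using (_∈?_)
  open import Data.Product using (_×_; _,_; proj₁; proj₂)
  open import Data.Empty using (⊥-elim)
  open import Relation.Nullary using (¬?)
  open import Relation.Binary.PropositionalEquality using (_≡_; refl; sym; trans; cong; subst)
  open import Function using (_∘_)
  open import Defs
  open Counting
  open FinSets
  open TotalBits

  -- The number of j ∈ B with B ∖ {j} ∈ 𝓕: the edges of the hypercube going
  -- down from B into 𝓕.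
  downEdges : Family → List ℕ → ℕ
  downEdges 𝓕 B = length (filter (λ j → remove j B ∈ᶠ? 𝓕) B)

  -- The number of hypercube edges with both ends in 𝓕.
  edges : Family → ℕ
  edges 𝓕 = sum (map (downEdges 𝓕) 𝓕)

  -- Every edge lies within lower, within upper, or joins
  -- X ∈ lower to X ∪ {s} ∈ upper; the last kind are counted by 'cross'.
  module TopSplit (N : ℕ) (𝓕 : Family) (𝓕! : Unique 𝓕) (inPow : All (InPow (suc N)) 𝓕) where

    s : ℕ
    s = suc N

    upper lower upper↓ : Family
    upper  = filter (λ X → s ∈? X) 𝓕
    lower  = filter (λ X → ¬? (s ∈? X)) 𝓕
    upper↓ = map dropMax upper

    cross : ℕ
    cross = length (filter (_∈ᶠ? lower) upper↓)

    upper-member : ∀ {X} → X ∈ upper → X ∈ 𝓕 × s ∈ X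
    upper-member = ∈-filter⁻ (λ X → s ∈? X) {xs = 𝓕}

    lower-member : ∀ {X} → X ∈ lower → X ∈ 𝓕 × s ∉ X
    lower-member = ∈-filter⁻ (λ X → ¬? (s ∈? X)) {xs = 𝓕}

    upper-head : ∀ {X} → X ∈ upper → X ≡ s ∷ dropMax X
    upper-head X∈ = max-head (All.lookup inPow (proj₁ (upper-member X∈))) (proj₂ (upper-member X∈))

    upper-decreasing : ∀ {X} → X ∈ upper → Decreasing (s ∷ dropMax X)
    upper-decreasing X∈ = subst Decreasing (upper-head X∈) (inPow⇒decreasing (All.lookup inPow (proj₁ (upper-member X∈))))

    lower! : Unique lower
    lower! = Unique.filter⁺ (λ X → ¬? (s ∈? X)) 𝓕!

    upper↓! : Unique upper↓
    upper↓! = unique-map⁺ (Unique.filter⁺ (λ X → s ∈? X) 𝓕!)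
      (λ X∈ Y∈ eq → trans (upper-head X∈) (trans (cong (s ∷_) eq) (sym (upper-head Y∈))))

    lower-inPow : All (InPow N) lower
    lower-inPow = All.tabulate λ X∈ → inPow-shrink (All.lookup inPow (proj₁ (lower-member X∈))) (proj₂ (lower-member X∈))

    upper↓-inPow : All (InPow N) upper↓
    upper↓-inPow = All.tabulate λ Y∈ → let (X , X∈ , Y≡) = ∈-map⁻ dropMax Y∈ in
      subst (InPow N) (sym Y≡) (inPow-dropMax (All.lookup inPow (proj₁ (upper-member X∈))))

    length-split : length upper↓ + length lower ≡ length 𝓕
    length-split = trans (cong (_+ length lower) (length-map dropMax upper))
                         (sym (length-filter-split (λ X → s ∈? X) 𝓕))

    cross≤upper↓ : cross ≤ length upper↓
    cross≤upper↓ = length-filter (_∈ᶠ? lower) upper↓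

    cross≤lower : cross ≤ length lower
    cross≤lower = unique-⊆⇒length-≤ (Unique.filter⁺ (_∈ᶠ? lower) upper↓!)
                                     (λ X∈ → proj₂ (∈-filter⁻ (_∈ᶠ? lower) {xs = upper↓} X∈))

    -- A set without s has all its lower neighbours in lower.
    lower-edges : sum (map (downEdges 𝓕) lower) ≤ edges lower
    lower-edges = sum-map-mono lower λ {B} B∈ →
      length-filter-mono (λ j → remove j B ∈ᶠ? 𝓕) (λ j → remove j B ∈ᶠ? lower) B
        λ _ B∖j∈𝓕 → ∈-filter⁺ (λ X → ¬? (s ∈? X)) B∖j∈𝓕
                      (λ s∈B∖j → proj₂ (lower-member B∈) (proj₁ (∈-remove⁻ s∈B∖j)))

    -- From {s} ∪ B′ one may remove s (an edge to lower iff B′ ∈ lower), or some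
    -- j ∈ B′ (an edge inside upper, i.e. an edge of upper↓ from B′).
    upper-downEdges : ∀ B′ → Decreasing (s ∷ B′) →
                      downEdges 𝓕 (s ∷ B′) ≤ indicator (_∈ᶠ? lower) B′ + downEdges upper↓ B′
    upper-downEdges B′ dec@(below-s ∷ _) = begin
      downEdges 𝓕 (s ∷ B′)                                         ≡⟨ length-filter-∷ (λ j → remove j (s ∷ B′) ∈ᶠ? 𝓕) s B′ ⟩
      indicator (λ j → remove j (s ∷ B′) ∈ᶠ? 𝓕) s
        + length (filter (λ j → remove j (s ∷ B′) ∈ᶠ? 𝓕) B′)        ≤⟨ +-mono-≤ remove-s remove-j ⟩
      indicator (_∈ᶠ? lower) B′ + downEdges upper↓ B′               ∎
      where
      open ≤-Reasoning
      remove-s : indicator (λ j → remove j (s ∷ B′) ∈ᶠ? 𝓕) s ≤ indicator (_∈ᶠ? lower) B′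
      remove-s = indicator-mono (λ j → remove j (s ∷ B′) ∈ᶠ? 𝓕) (_∈ᶠ? lower) s B′ λ B∖s∈𝓕 →
        ∈-filter⁺ (λ X → ¬? (s ∈? X)) (subst (_∈ 𝓕) (remove-head s B′ dec) B∖s∈𝓕) (head∉tail dec)
      remove-j : length (filter (λ j → remove j (s ∷ B′) ∈ᶠ? 𝓕) B′) ≤ downEdges upper↓ B′
      remove-j = length-filter-mono (λ j → remove j (s ∷ B′) ∈ᶠ? 𝓕) (λ j → remove j B′ ∈ᶠ? upper↓) B′
        λ {j} j∈B′ B∖j∈𝓕 → ∈-map⁺ dropMax (∈-filter⁺ (λ X → s ∈? X)
          (subst (_∈ 𝓕) (remove-∷ j s B′ (λ j≡s → <-irrefl j≡s (All.lookup below-s j∈B′))) B∖j∈𝓕)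
          (here refl))

    upper-edges : sum (map (downEdges 𝓕) upper) ≤ cross + edges upper↓
    upper-edges = begin
      sum (map (downEdges 𝓕) upper)             ≤⟨ sum-map-mono upper bound ⟩
      sum (map (edgesFromBelow ∘ dropMax) upper) ≡⟨ cong sum (map-∘ upper) ⟩
      sum (map edgesFromBelow upper↓)            ≡⟨ sum-map-+ (indicator (_∈ᶠ? lower)) (downEdges upper↓) upper↓ ⟩
      sum (map (indicator (_∈ᶠ? lower)) upper↓) + edges upper↓
                                                 ≡⟨ cong (_+ edges upper↓) (sum-indicator (_∈ᶠ? lower) upper↓) ⟩
      cross + edges upper↓                       ∎
      where
      open ≤-Reasoning
      edgesFromBelow : List ℕ → ℕ
      edgesFromBelow B′ = indicator (_∈ᶠ? lower) B′ + downEdges upper↓ B′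
      bound : ∀ {B} → B ∈ upper → downEdges 𝓕 B ≤ edgesFromBelow (dropMax B)
      bound {B} B∈ = subst (λ X → downEdges 𝓕 X ≤ edgesFromBelow (dropMax X)) (sym (upper-head B∈))
                           (upper-downEdges (dropMax B) (upper-decreasing B∈))

    edges-split : edges 𝓕 ≤ cross + edges upper↓ + edges lower
    edges-split = begin
      edges 𝓕                                                         ≡⟨ sum-filter-split (λ X → s ∈? X) (downEdges 𝓕) 𝓕 ⟩
      sum (map (downEdges 𝓕) upper) + sum (map (downEdges 𝓕) lower)  ≤⟨ +-mono-≤ upper-edges lower-edges ⟩
      cross + edges upper↓ + edges lower                              ∎
      where open ≤-Reasoning

  -- Edge-isoperimetric inequality (Harper, Bernstein, Hart): m subsets of [N]
  -- span at most totalBits m edges of the hypercube.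
  edges-≤-totalBits : ∀ N 𝓕 → Unique 𝓕 → All (InPow N) 𝓕 → edges 𝓕 ≤ totalBits (length 𝓕)
  edges-≤-totalBits zero 𝓕 _ inPow = ≤-trans (≤-reflexive no-edges) z≤n
    where
    empty-no-edges : ∀ {X} → X ∈ 𝓕 → downEdges 𝓕 X ≤ 0
    empty-no-edges X∈ with All.lookup inPow X∈
    ... | (_ , _) , []              = z≤n
    ... | (1≤x ∷ _ , _) , x≤0 ∷ _ = ⊥-elim (<⇒≱ 1≤x x≤0)
    no-edges : edges 𝓕 ≡ 0
    no-edges = n≤0⇒n≡0 (≤-trans (sum-map-mono 𝓕 empty-no-edges) (≤-reflexive (sum-map-zero 𝓕)))
  edges-≤-totalBits (suc N) 𝓕 𝓕! inPow = begin
    edges 𝓕                                                   ≤⟨ edges-split ⟩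
    cross + edges upper↓ + edges lower                         ≤⟨ +-mono-≤ (+-monoʳ-≤ cross (edges-≤-totalBits N upper↓ upper↓! upper↓-inPow))
                                                                           (edges-≤-totalBits N lower lower! lower-inPow) ⟩
    cross + totalBits (length upper↓) + totalBits (length lower) ≡⟨ rotate cross _ _ ⟩
    totalBits (length upper↓) + totalBits (length lower) + cross ≤⟨ totalBits-superadditive _ _ cross cross≤upper↓ cross≤lower ⟩
    totalBits (length upper↓ + length lower)                   ≡⟨ cong totalBits length-split ⟩
    totalBits (length 𝓕)                                       ∎
    where
    open TopSplit N 𝓕 𝓕! inPow
    open ≤-Reasoning
    rotate : ∀ c a b → c + a + b ≡ a + b + c
    rotate c a b = trans (+-assoc c a b) (+-comm c (a + b))

module DegreeSum where

  open import Data.Nat using (ℕ; suc; _+_; _*_; _≤_; _<_; z≤n)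
  open import Data.Nat.Properties
  open import Data.Nat.ListAction using (sum)
  open import Data.List using (List; []; _∷_; length; filter; map)
  open import Data.List.Relation.Unary.Any using (here; there)
  open import Data.List.Relation.Unary.Unique.Propositional using (Unique)
  import Data.List.Relation.Unary.Unique.Propositional.Properties as Unique
  open import Data.List.Membership.Propositional using (_∈_)
  open import Data.List.Membership.Propositional.Properties using (∈-filter⁻)
  open import Data.List.Membership.DecPropositional _≟_ using (_∈?_)
  open import Data.Product using (proj₂)
  open import Relation.Binary.PropositionalEquality using (_≡_; refl; cong)
  open import Data.Nat.Tactic.RingSolver using (solve-∀)
  open import Function using (_∘_)
  open import Defs
  open Counting

  -- Summing degrees over distinct points counts each B ∈ ℬ at most |B| times.
  degree-sum-≤-norm : ∀ js ℬ → Unique js → sum (map (λ j → deg j ℬ) js) ≤ norm ℬ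
  degree-sum-≤-norm js ℬ js! = begin
    sum (map (λ j → deg j ℬ) js)                            ≡⟨ double-count (λ j B → j ∈? B) js ℬ ⟩
    sum (map (λ B → length (filter (λ j → j ∈? B) js)) ℬ)  ≤⟨ sum-map-mono ℬ (λ _ → points-in-B) ⟩
    norm ℬ                                                  ∎
    where
    open ≤-Reasoning
    points-in-B : ∀ {B} → length (filter (λ j → j ∈? B) js) ≤ length B
    points-in-B {B} = unique-⊆⇒length-≤ (Unique.filter⁺ (λ j → j ∈? B) js!)
                                         (λ j∈ → proj₂ (∈-filter⁻ (λ j → j ∈? B) {xs = js} j∈))

  module _ (m : ℕ) (f : ℕ → ℕ) where

    sum-lower-bound : ∀ js → (∀ {j} → j ∈ js → m < 2 * f j) → length js * suc m ≤ 2 * sum (map f js)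
    sum-lower-bound []       _     = z≤n
    sum-lower-bound (j ∷ js) large = begin
      suc m + length js * suc m    ≤⟨ +-mono-≤ (large (here refl)) (sum-lower-bound js (large ∘ there)) ⟩
      2 * f j + 2 * sum (map f js) ≡⟨ *-distribˡ-+ 2 (f j) _ ⟨
      2 * sum (map f (j ∷ js))     ∎
      where
      open ≤-Reasoning

    sum-lower-bound-at : ∀ js → (∀ {j} → j ∈ js → m < 2 * f j) → ∀ {i} → i ∈ js →
                         2 * f i + length js * suc m ≤ 2 * sum (map f js) + suc m
    sum-lower-bound-at (i ∷ js) large (here refl) = begin
      2 * f i + (suc m + length js * suc m)     ≡⟨ regroup (2 * f i) (suc m) _ ⟩
      2 * f i + length js * suc m + suc m       ≤⟨ +-monoˡ-≤ (suc m) (+-monoʳ-≤ (2 * f i) (sum-lower-bound js (large ∘ there))) ⟩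
      2 * f i + 2 * sum (map f js) + suc m      ≡⟨ cong (_+ suc m) (*-distribˡ-+ 2 (f i) _) ⟨
      2 * sum (map f (i ∷ js)) + suc m          ∎
      where
      open ≤-Reasoning
      regroup : ∀ a b c → a + (b + c) ≡ a + c + b
      regroup = solve-∀
    sum-lower-bound-at (j ∷ js) large {i} (there i∈js) = begin
      2 * f i + (suc m + length js * suc m)     ≡⟨ regroup (2 * f i) (suc m) _ ⟩
      suc m + (2 * f i + length js * suc m)     ≤⟨ +-mono-≤ (large (here refl)) (sum-lower-bound-at js (large ∘ there) i∈js) ⟩
      2 * f j + (2 * sum (map f js) + suc m)    ≡⟨ +-assoc (2 * f j) _ (suc m) ⟨
      2 * f j + 2 * sum (map f js) + suc m      ≡⟨ cong (_+ suc m) (*-distribˡ-+ 2 (f j) _) ⟨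
      2 * sum (map f (j ∷ js)) + suc m          ∎
      where
      open ≤-Reasoning
      regroup : ∀ a b c → a + (b + c) ≡ b + (a + c)
      regroup = solve-∀

module CounterexampleFacts where

  open import Data.Nat using (ℕ; zero; suc; _+_; _*_; _≤_; _<_; z≤n; s≤s)
  open import Data.Nat.Properties
  open import Data.List using (List; []; _∷_; [_]; _++_; length; filter; map)
  open import Data.List.Properties using (length-map; length-++; filter-++)
  open import Data.List.Relation.Unary.All using (All; []; _∷_)
  import Data.List.Relation.Unary.All as All
  open import Data.List.Relation.Unary.Any using (here)
  open import Data.List.Relation.Unary.Unique.Propositional using (Unique)
  import Data.List.Relation.Unary.Unique.Propositional.Properties as Unique
  open import Data.List.Membership.Propositional using (_∈_; _∉_)
  open import Data.List.Membership.Propositional.Properties using (∈-filter⁺; ∈-filter⁻; ∈-map⁻; ∈-++⁺ˡ; ∈-++⁺ʳ; ∈-++⁻)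
  open import Data.List.Membership.DecPropositional _≟_ using (_∈?_)
  open import Data.Product using (_×_; _,_; proj₁; proj₂)
  open import Data.Sum using (_⊎_; inj₁; inj₂; [_,_]′)
  open import Data.Empty using (⊥; ⊥-elim)
  open import Relation.Nullary using (¬_; Dec; yes; no; ¬?)
  open import Relation.Binary.PropositionalEquality using (_≡_; _≢_; refl; sym; trans; cong; cong₂; subst)
  open import Function using (_∘_)
  open import Data.Nat.Tactic.RingSolver using (solve-∀)
  open import Defs
  open Counting
  open FinSets
  open Edges

  -- In a family containing every subset of [n], the sets avoiding a point
  -- j ∈ [n] are at most as many as those containing it: X ↦ X ∪ {j} injects
  -- the former into the latter.
  avoiding-≤-containing : ∀ {n j} 𝒰 → Unique 𝒰 → All (InPow n) 𝒰 → (∀ {X} → InPow n X → X ∈ 𝒰) →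
                          1 ≤ j → j ≤ n →
                          length (filter (λ X → ¬? (j ∈? X)) 𝒰) ≤ length (filter (λ X → j ∈? X) 𝒰)
  avoiding-≤-containing {n} {j} 𝒰 𝒰! inPow complete 1≤j j≤n =
    subst (_≤ length containing) (length-map (insert j) avoiding)
      (unique-⊆⇒length-≤ (unique-map⁺ (Unique.filter⁺ (λ X → ¬? (j ∈? X)) 𝒰!) insert-j-injective) insert-j-lands)
    where
    avoiding containing : Family
    avoiding   = filter (λ X → ¬? (j ∈? X)) 𝒰
    containing = filter (λ X → j ∈? X) 𝒰
    avoiding-member : ∀ {X} → X ∈ avoiding → X ∈ 𝒰 × j ∉ X
    avoiding-member = ∈-filter⁻ (λ X → ¬? (j ∈? X)) {xs = 𝒰}
    decreasing : ∀ {X} → X ∈ avoiding → Decreasing X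
    decreasing = inPow⇒decreasing ∘ All.lookup inPow ∘ proj₁ ∘ avoiding-member
    insert-j-injective : ∀ {X Y} → X ∈ avoiding → Y ∈ avoiding → insert j X ≡ insert j Y → X ≡ Y
    insert-j-injective X∈ Y∈ = insert-injective j _ _ (decreasing X∈) (decreasing Y∈)
                                                 (proj₂ (avoiding-member X∈)) (proj₂ (avoiding-member Y∈))
    insert-j-lands : ∀ {Z} → Z ∈ map (insert j) avoiding → Z ∈ containing
    insert-j-lands Z∈ with ∈-map⁻ (insert j) Z∈
    ... | X , X∈ , refl = ∈-filter⁺ (λ X → j ∈? X)
            (complete (insert-inPow 1≤j j≤n (All.lookup inPow (proj₁ (avoiding-member X∈))) (proj₂ (avoiding-member X∈))))
            (∈-insert-new j X)

  module CounterexampleComplement (n : ℕ) (𝒜 ℬ : Family)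
    (counterexample : Counterexample n 𝒜) (complement : IsComplementIn n 𝒜 ℬ) where

    private
      𝒜-family : IsFamilyIn n 𝒜
      𝒜-family = proj₁ counterexample

      𝒜-unionClosed : UnionClosed 𝒜
      𝒜-unionClosed = proj₁ (proj₂ counterexample)

      𝒜-rare : ∀ i → 1 ≤ i → 2 * deg i 𝒜 < length 𝒜
      𝒜-rare = proj₂ (proj₂ (proj₂ counterexample))

      ℬ-family : IsFamilyIn n ℬ
      ℬ-family = proj₁ complement

      split : ∀ X → InPow n X → (X ∈ ℬ → X ∉ 𝒜) × (X ∉ 𝒜 → X ∈ ℬ)
      split = proj₂ complement

      𝒜-inPow : ∀ {X} → X ∈ 𝒜 → InPow n X
      𝒜-inPow = All.lookup (proj₁ 𝒜-family)

      ℬ-inPow : ∀ {X} → X ∈ ℬ → InPow n X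
      ℬ-inPow = All.lookup (proj₁ ℬ-family)

      ∈ℬ⇒∉𝒜 : ∀ {X} → X ∈ ℬ → X ∉ 𝒜
      ∈ℬ⇒∉𝒜 X∈ℬ = proj₁ (split _ (ℬ-inPow X∈ℬ)) X∈ℬ

      ∉ℬ⇒∈𝒜 : ∀ {X} → InPow n X → X ∉ ℬ → X ∈ 𝒜
      ∉ℬ⇒∈𝒜 {X} X⊆[n] X∉ℬ with X ∈ᶠ? 𝒜
      ... | yes X∈𝒜 = X∈𝒜
      ... | no  X∉𝒜 = ⊥-elim (X∉ℬ (proj₂ (split X X⊆[n]) X∉𝒜))

      𝒰 : Family
      𝒰 = 𝒜 ++ ℬ

      𝒰! : Unique 𝒰
      𝒰! = Unique.++⁺ (proj₂ 𝒜-family) (proj₂ ℬ-family) (λ (X∈𝒜 , X∈ℬ) → ∈ℬ⇒∉𝒜 X∈ℬ X∈𝒜)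

      𝒰-inPow : All (InPow n) 𝒰
      𝒰-inPow = All.tabulate λ X∈ → [ 𝒜-inPow , ℬ-inPow ]′ (∈-++⁻ 𝒜 X∈)

      𝒰-complete : ∀ {X} → InPow n X → X ∈ 𝒰
      𝒰-complete {X} X⊆[n] with X ∈ᶠ? 𝒜
      ... | yes X∈𝒜 = ∈-++⁺ˡ X∈𝒜
      ... | no  X∉𝒜 = ∈-++⁺ʳ 𝒜 (proj₂ (split X X⊆[n]) X∉𝒜)

      -- With W, O the numbers of sets of 𝒰 containing and avoiding j:
      -- |ℬ| + |𝒜| = W + O ≤ 2W = 2 deg_𝒜 + 2 deg_ℬ < |𝒜| + 2 deg_ℬ.
      degree-arithmetic : ∀ m a W O dA dB → m + a ≡ W + O → O ≤ W → W ≡ dA + dB → 2 * dA < a → m < 2 * dB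
      degree-arithmetic m a W O dA dB m+a≡W+O O≤W W≡ 2dA<a = +-cancelʳ-< a m (2 * dB) (begin-strict
        m + a                  ≡⟨ m+a≡W+O ⟩
        W + O                  ≤⟨ +-monoʳ-≤ W O≤W ⟩
        W + W                  ≡⟨ cong₂ _+_ W≡ W≡ ⟩
        (dA + dB) + (dA + dB)  ≡⟨ double dA dB ⟩
        2 * dA + 2 * dB        <⟨ +-monoˡ-< (2 * dB) 2dA<a ⟩
        a + 2 * dB             ≡⟨ +-comm a (2 * dB) ⟩
        2 * dB + a             ∎)
        where
        open ≤-Reasoning
        double : ∀ x y → (x + y) + (x + y) ≡ 2 * x + 2 * y
        double = solve-∀

    -- Every point of [n] lies in more than half of the sets of ℬ: it lies in
    -- at least half of all subsets of [n], but in fewer than half of 𝒜.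
    degree-bound : ∀ j → 1 ≤ j → j ≤ n → length ℬ < 2 * deg j ℬ
    degree-bound j 1≤j j≤n =
      degree-arithmetic (length ℬ) (length 𝒜) (deg j 𝒰) (length (filter (λ X → ¬? (j ∈? X)) 𝒰))
        (deg j 𝒜) (deg j ℬ) sizes (avoiding-≤-containing 𝒰 𝒰! 𝒰-inPow 𝒰-complete 1≤j j≤n)
        degrees (𝒜-rare j 1≤j)
      where
      sizes : length ℬ + length 𝒜 ≡ deg j 𝒰 + length (filter (λ X → ¬? (j ∈? X)) 𝒰)
      sizes = trans (+-comm (length ℬ) (length 𝒜))
                    (trans (sym (length-++ 𝒜)) (length-filter-split (λ X → j ∈? X) 𝒰))
      degrees : deg j 𝒰 ≡ deg j 𝒜 + deg j ℬ
      degrees = trans (cong length (filter-++ (λ X → j ∈? X) 𝒜 ℬ)) (length-++ (filter (λ X → j ∈? X) 𝒜))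

    -- For B ∈ ℬ there is at most one j ∈ B with B ∖ {j} ∉ ℬ: two such sets
    -- would lie in 𝒜, and so would their union B.
    missing-neighbour-unique : ∀ {B} → B ∈ ℬ → ∀ {j k} → j ∈ B → k ∈ B →
                               remove j B ∉ ℬ → remove k B ∉ ℬ → j ≡ k
    missing-neighbour-unique {B} B∈ℬ {j} {k} j∈B k∈B B∖j∉ℬ B∖k∉ℬ with j ≟ k
    ... | yes j≡k = j≡k
    ... | no  j≢k with 𝒜-unionClosed _ _ (∉ℬ⇒∈𝒜 (remove-inPow (ℬ-inPow B∈ℬ)) B∖j∉ℬ) (∉ℬ⇒∈𝒜 (remove-inPow (ℬ-inPow B∈ℬ)) B∖k∉ℬ)
    ...   | Z , Z∈𝒜 , Z≡∪ = ⊥-elim (∈ℬ⇒∉𝒜 B∈ℬ (subst (_∈ 𝒜) Z≡B Z∈𝒜))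
      where
      Z≡B : Z ≡ B
      Z≡B = decreasing-ext Z B (inPow⇒decreasing (𝒜-inPow Z∈𝒜)) (inPow⇒decreasing (ℬ-inPow B∈ℬ))
        (λ {x} x∈Z → [ proj₁ ∘ ∈-remove⁻ , proj₁ ∘ ∈-remove⁻ ]′ (proj₁ (Z≡∪ x) x∈Z))
        (λ {x} x∈B → proj₂ (Z≡∪ x) (in-union x∈B))
        where
        in-union : ∀ {x} → x ∈ B → x ∈ remove j B ⊎ x ∈ remove k B
        in-union {x} x∈B with x ≟ j
        ... | yes refl = inj₂ (∈-remove⁺ x∈B j≢k)
        ... | no  x≢j  = inj₁ (∈-remove⁺ x∈B x≢j)

    -- Hence ‖ℬ‖ ≤ e(ℬ) + |ℬ|: all but at most one removal from B ∈ ℬ is an edge of ℬ.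
    norm-≤-edges : norm ℬ ≤ edges ℬ + length ℬ
    norm-≤-edges = subst (norm ℬ ≤_) (sum-map-suc (downEdges ℬ) ℬ) (sum-map-mono ℬ size-bound)
      where
      size-bound : ∀ {B} → B ∈ ℬ → length B ≤ suc (downEdges ℬ B)
      size-bound {B} B∈ℬ = begin
        length B                                                      ≡⟨ length-filter-split edge? B ⟩
        downEdges ℬ B + length (filter (λ j → ¬? (edge? j)) B)       ≤⟨ +-monoʳ-≤ (downEdges ℬ B) at-most-one ⟩
        downEdges ℬ B + 1                                             ≡⟨ +-comm (downEdges ℬ B) 1 ⟩
        suc (downEdges ℬ B)                                           ∎
        where
        open ≤-Reasoning
        edge? : ∀ j → Dec (remove j B ∈ ℬ)
        edge? j = remove j B ∈ᶠ? ℬ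
        missing-member : ∀ {j} → j ∈ filter (λ j → ¬? (edge? j)) B → j ∈ B × remove j B ∉ ℬ
        missing-member = ∈-filter⁻ (λ j → ¬? (edge? j)) {xs = B}
        at-most-one : length (filter (λ j → ¬? (edge? j)) B) ≤ 1
        at-most-one = unique-constant⇒length-≤1
          (Unique.filter⁺ (λ j → ¬? (edge? j)) (decreasing⇒unique (inPow⇒decreasing (ℬ-inPow B∈ℬ))))
          λ j∈ k∈ → missing-neighbour-unique B∈ℬ (proj₁ (missing-member j∈)) (proj₁ (missing-member k∈))
                                                 (proj₂ (missing-member j∈)) (proj₂ (missing-member k∈))

  -- There is no counterexample inside 𝒫([1]) = {∅, {1}}: every set of 𝒜 but
  -- ∅ contains 1, so 2·deg(1) < |𝒜| forces 𝒜 = {∅}.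
  no-counterexample-in-[1] : ∀ 𝒜 → ¬ Counterexample 1 𝒜
  no-counterexample-in-[1] 𝒜 ((inPow , 𝒜!) , _ , 𝒜≢[∅] , rare) =
    singleton-case 𝒜 inPow (rare 1 ≤-refl) size≤1 𝒜≢[∅]
    where
    avoids-1⇒empty : ∀ {X} → InPow 1 X → 1 ∉ X → X ≡ []
    avoids-1⇒empty {[]}    _                           _   = refl
    avoids-1⇒empty {x ∷ _} ((1≤x ∷ _ , _) , x≤1 ∷ _) 1∉X = ⊥-elim (1∉X (here (≤-antisym 1≤x x≤1)))
    avoiding : Family
    avoiding = filter (λ X → ¬? (1 ∈? X)) 𝒜
    avoiding-member : ∀ {X} → X ∈ avoiding → X ∈ 𝒜 × 1 ∉ X
    avoiding-member = ∈-filter⁻ (λ X → ¬? (1 ∈? X)) {xs = 𝒜}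
    avoiding≤1 : length avoiding ≤ 1
    avoiding≤1 = unique-constant⇒length-≤1 (Unique.filter⁺ (λ X → ¬? (1 ∈? X)) 𝒜!) λ X∈ Y∈ →
      trans (avoids-1⇒empty (All.lookup inPow (proj₁ (avoiding-member X∈))) (proj₂ (avoiding-member X∈)))
            (sym (avoids-1⇒empty (All.lookup inPow (proj₁ (avoiding-member Y∈))) (proj₂ (avoiding-member Y∈))))
    -- |𝒜| = deg(1) + #avoiding ≤ deg(1) + 1 together with 2·deg(1) < |𝒜|.
    size≤1 : length 𝒜 ≤ 1
    size≤1 = small (deg 1 𝒜) (length-filter-split (λ X → 1 ∈? X) 𝒜) avoiding≤1 (rare 1 ≤-refl)
      where
      small : ∀ d {o a} → a ≡ d + o → o ≤ 1 → 2 * d < a → a ≤ 1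
      small zero    refl o≤1 _   = o≤1
      small (suc d) {o} refl o≤1 2d<a = ⊥-elim (<⇒≱ 2d<a (begin
        suc d + o        ≤⟨ +-monoʳ-≤ (suc d) (≤-trans o≤1 (s≤s z≤n)) ⟩
        suc d + suc d    ≡⟨ cong (suc d +_) (sym (+-identityʳ (suc d))) ⟩
        2 * suc d        ∎))
        where open ≤-Reasoning
    singleton-case : ∀ 𝒜′ → All (InPow 1) 𝒜′ → 2 * deg 1 𝒜′ < length 𝒜′ → length 𝒜′ ≤ 1 → 𝒜′ ≢ [ [] ] → ⊥
    singleton-case []            _          ()  _         _
    singleton-case (_ ∷ _ ∷ _)   _          _   (s≤s ())  _
    singleton-case (X ∷ [])      (X⊆[1] ∷ []) rare′ _       X≢∅ with 1 ∈? X
    ... | yes _   = <⇒≱ rare′ (s≤s z≤n)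
    ... | no  1∉X = X≢∅ (cong [_] (avoids-1⇒empty X⊆[1] 1∉X))

module IntegerBound where

  open import Data.Nat using (ℕ; zero; suc; _+_; _*_; _≤_; _<_; z≤n; s≤s)
  open import Data.Nat.Properties
  open import Data.Nat.ListAction using (sum)
  open import Data.List using (List; length; map; applyUpTo)
  open import Data.List.Properties using (length-applyUpTo)
  open import Data.List.Relation.Unary.Unique.Propositional using (Unique)
  import Data.List.Relation.Unary.Unique.Propositional.Properties as Unique
  open import Data.List.Membership.Propositional using (_∈_)
  open import Data.List.Membership.Propositional.Properties using (∈-applyUpTo⁺; ∈-applyUpTo⁻)
  open import Data.Product using (_×_; _,_; proj₁; proj₂)
  open import Data.Empty using (⊥-elim)
  open import Relation.Binary.PropositionalEquality using (_≡_; refl; sym; cong; subst₂)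
  open import Data.Nat.Tactic.RingSolver using (solve-∀)
  open import Defs
  open TotalBits
  open Edges
  open InitialColex
  open DegreeSum
  open CounterexampleFacts

  points : ℕ → List ℕ
  points n = applyUpTo suc n

  points! : ∀ n → Unique (points n)
  points! n = Unique.applyUpTo⁺₁ suc n (λ i<j _ 1+i≡1+j → <⇒≢ i<j (suc-injective 1+i≡1+j))

  ∈-points⁺ : ∀ {n i} → 1 ≤ i → i ≤ n → i ∈ points n
  ∈-points⁺ {n} {suc i} _ i<n = ∈-applyUpTo⁺ suc i<n

  ∈-points⁻ : ∀ {n j} → j ∈ points n → 1 ≤ j × j ≤ n
  ∈-points⁻ j∈ with ∈-applyUpTo⁻ suc j∈
  ... | i , i<n , refl = s≤s z≤n , i<n

  two-≤-dimension : ∀ {n 𝒜} → Counterexample n 𝒜 → 1 ≤ n → 2 ≤ n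
  two-≤-dimension {zero}        _              ()
  two-≤-dimension {suc zero}    {𝒜} counterexample _ = ⊥-elim (no-counterexample-in-[1] 𝒜 counterexample)
  two-≤-dimension {suc (suc _)} _              _ = s≤s (s≤s z≤n)

  clear-arithmetic : ∀ m n d N → 2 ≤ n → 2 * d + n * suc m ≤ 2 * (N + m) + suc m →
                     m * n + (d + d) < (N + N) + m * 3
  clear-arithmetic m zero          d N ()        _
  clear-arithmetic m (suc zero)    d N (s≤s ()) _
  clear-arithmetic m (suc (suc k)) d N _ bound =
    ≤-trans (m≤m+n (suc (m * suc (suc k) + (d + d))) k) (≤-pred (subst₂ _≤_ (lhs m k d) (rhs m N) bound))
    where
    lhs : ∀ m k d → 2 * d + suc (suc k) * suc m ≡ suc (suc (m * suc (suc k) + (d + d)) + k)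
    lhs = solve-∀
    rhs : ∀ m N → 2 * (N + m) + suc m ≡ suc ((N + N) + m * 3)
    rhs = solve-∀

  -- The theorem with the rational parameter p eliminated:
  -- |ℬ|·n + 2·deg_ℬ(i) < 2‖𝓘(|ℬ|)‖ + 3|ℬ|.
  integer-bound : ∀ n 𝒜 ℬ → Counterexample n 𝒜 → IsComplementIn n 𝒜 ℬ →
                  ∀ i → 1 ≤ i → i ≤ n → ∀ 𝓘 → IsInitialColex 𝓘 (length ℬ) →
                  length ℬ * n + (deg i ℬ + deg i ℬ) < (norm 𝓘 + norm 𝓘) + length ℬ * 3
  integer-bound n 𝒜 ℬ counterexample complement i 1≤i i≤n 𝓘 initial =
    clear-arithmetic m n (deg i ℬ) (norm 𝓘) (two-≤-dimension counterexample (≤-trans 1≤i i≤n)) (begin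
      2 * deg i ℬ + n * suc m                      ≡⟨ cong (λ l → 2 * deg i ℬ + l * suc m) (sym (length-applyUpTo suc n)) ⟩
      2 * deg i ℬ + length (points n) * suc m      ≤⟨ sum-lower-bound-at m (λ j → deg j ℬ) (points n)
                                                        (λ j∈ → let (1≤j , j≤n) = ∈-points⁻ j∈ in degree-bound _ 1≤j j≤n)
                                                        (∈-points⁺ 1≤i i≤n) ⟩
      2 * sum (map (λ j → deg j ℬ) (points n)) + suc m
                                                   ≤⟨ +-monoˡ-≤ (suc m) (*-monoʳ-≤ 2 degree-sum-bound) ⟩
      2 * (norm 𝓘 + m) + suc m                     ∎)
    where
    open ≤-Reasoning
    open CounterexampleComplement n 𝒜 ℬ counterexample complement
    m : ℕ
    m = length ℬ
    ℬ-family : IsFamilyIn n ℬ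
    ℬ-family = proj₁ complement
    degree-sum-bound : sum (map (λ j → deg j ℬ) (points n)) ≤ norm 𝓘 + m
    degree-sum-bound = begin
      sum (map (λ j → deg j ℬ) (points n))  ≤⟨ degree-sum-≤-norm (points n) ℬ (points! n) ⟩
      norm ℬ                                ≤⟨ norm-≤-edges ⟩
      edges ℬ + m                           ≤⟨ +-monoˡ-≤ m (edges-≤-totalBits n ℬ (proj₂ ℬ-family) (proj₁ ℬ-family)) ⟩
      totalBits m + m                       ≤⟨ +-monoˡ-≤ m (totalBits-≤-norm initial) ⟩
      norm 𝓘 + m                            ∎

module RationalBound where

  open import Data.Nat as ℕ using (ℕ)
  open import Data.Integer as ℤ using (ℤ; +_)
  import Data.Integer.Properties as ℤ
  open import Data.Integer.Tactic.RingSolver using (solve-∀)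
  open import Data.Rational using (ℚ; _/_; 1ℚ; ½; _+_; _-_; _*_; -_; _<_; toℚᵘ)
  open import Data.Rational.Properties
  import Data.Rational.Unnormalised as ℚᵘ
  import Data.Rational.Unnormalised.Properties as ℚᵘ
  open import Data.Rational.Solver using (module +-*-Solver)
  open import Relation.Nullary using (yes; no)
  open import Data.Empty using (⊥-elim)
  open import Relation.Binary.PropositionalEquality using (_≡_; refl; sym; trans; cong; cong₂; subst; subst₂; module ≡-Reasoning)

  -- The natural number k as a rational, written as in the statement.
  ι : ℕ → ℚ
  ι k = (+ k) / 1

  private
    ι≃ : ∀ k → toℚᵘ (ι k) ℚᵘ.≃ ℚᵘ.mkℚᵘ (+ k) 0
    ι≃ k = toℚᵘ-fromℚᵘ (ℚᵘ.mkℚᵘ (+ k) 0)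

  ι-+ : ∀ a b → ι (a ℕ.+ b) ≡ ι a + ι b
  ι-+ a b = toℚᵘ-injective (ℚᵘ.≃-trans (ι≃ (a ℕ.+ b)) (ℚᵘ.≃-trans sum≃
    (ℚᵘ.≃-sym (ℚᵘ.≃-trans (toℚᵘ-homo-+ (ι a) (ι b)) (ℚᵘ.+-cong (ι≃ a) (ι≃ b))))))
    where
    sum≃ : ℚᵘ.mkℚᵘ (+ (a ℕ.+ b)) 0 ℚᵘ.≃ ℚᵘ.mkℚᵘ (+ a) 0 ℚᵘ.+ ℚᵘ.mkℚᵘ (+ b) 0
    sum≃ = ℚᵘ.*≡* (trans (cong (ℤ._* + 1) (ℤ.pos-+ a b)) (identity (+ a) (+ b)))
      where
      identity : ∀ (x y : ℤ) → (x ℤ.+ y) ℤ.* + 1 ≡ (x ℤ.* + 1 ℤ.+ y ℤ.* + 1) ℤ.* + 1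
      identity = solve-∀

  ι-* : ∀ a b → ι (a ℕ.* b) ≡ ι a * ι b
  ι-* a b = toℚᵘ-injective (ℚᵘ.≃-trans (ι≃ (a ℕ.* b)) (ℚᵘ.≃-trans product≃
    (ℚᵘ.≃-sym (ℚᵘ.≃-trans (toℚᵘ-homo-* (ι a) (ι b)) (ℚᵘ.*-cong (ι≃ a) (ι≃ b))))))
    where
    product≃ : ℚᵘ.mkℚᵘ (+ (a ℕ.* b)) 0 ℚᵘ.≃ ℚᵘ.mkℚᵘ (+ a) 0 ℚᵘ.* ℚᵘ.mkℚᵘ (+ b) 0
    product≃ = ℚᵘ.*≡* (cong (ℤ._* + 1) (ℤ.pos-* a b))

  ι-< : ∀ {a b} → a ℕ.< b → ι a < ι b
  ι-< {a} {b} a<b = toℚᵘ-cancel-< (ℚᵘ.<-respʳ-≃ (ℚᵘ.≃-sym (ι≃ b)) (ℚᵘ.<-respˡ-≃ (ℚᵘ.≃-sym (ι≃ a))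
    (ℚᵘ.*<* (subst₂ ℤ._<_ (sym (ℤ.*-identityʳ (+ a))) (sym (ℤ.*-identityʳ (+ b))) (ℤ.+<+ a<b)))))

  half+half : ∀ n → (+ n) / 2 + (+ n) / 2 ≡ ι n
  half+half n = toℚᵘ-injective (ℚᵘ.≃-trans (toℚᵘ-homo-+ ((+ n) / 2) ((+ n) / 2))
    (ℚᵘ.≃-trans (ℚᵘ.+-cong (toℚᵘ-fromℚᵘ half) (toℚᵘ-fromℚᵘ half)) (ℚᵘ.≃-trans sum≃ (ℚᵘ.≃-sym (ι≃ n)))))
    where
    half : ℚᵘ.ℚᵘ
    half = ℚᵘ.mkℚᵘ (+ n) 1
    sum≃ : half ℚᵘ.+ half ℚᵘ.≃ ℚᵘ.mkℚᵘ (+ n) 0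
    sum≃ = ℚᵘ.*≡* (identity (+ n))
      where
      identity : ∀ (x : ℤ) → (x ℤ.* + 2 ℤ.+ x ℤ.* + 2) ℤ.* + 1 ≡ x ℤ.* + 4
      identity = solve-∀

  halve-< : ∀ p q → p + p < q + q → p < q
  halve-< p q p+p<q+q with p <? q
  ... | yes p<q = p<q
  ... | no  p≮q = ⊥-elim (<-irrefl refl (≤-<-trans (+-mono-≤ (≮⇒≥ p≮q) (≮⇒≥ p≮q)) p+p<q+q))

  move-right : ∀ {x y z} → x < z + y → x - y < z
  move-right {x} {y} {z} x<z+y = subst (x - y <_) (cancel z y) (+-monoˡ-< (- y) x<z+y)
    where
    open +-*-Solver
    cancel : ∀ z y → z + y - y ≡ z
    cancel = solve 2 (λ z y → z :+ y :- y := z) refl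

  -- Clearing p: if d = m(1/2 + p), then twice m(n/2 - 1 + p) is mn + 2d - 3m.
  twice-scaled : ∀ m n d p → ι d ≡ ι m * (½ + p) →
                 ι m * (((+ n) / 2 - 1ℚ) + p) + ι m * (((+ n) / 2 - 1ℚ) + p) ≡
                 ι (m ℕ.* n ℕ.+ (d ℕ.+ d)) - ι (m ℕ.* 3)
  twice-scaled m n d p d≡ = begin
    M * ((A - 1ℚ) + p) + M * ((A - 1ℚ) + p)                          ≡⟨ expand M A 1ℚ p ½ ⟩
    (M * (½ + p) + M * (½ + p)) + (M * (A + A) - M * ((1ℚ + 1ℚ) + (½ + ½)))
                                                                    ≡⟨ cong₂ (λ u v → (u + u) + (M * v - M * ι 3)) (sym d≡) (half+half n) ⟩
    (ι d + ι d) + (M * ι n - M * ι 3)                               ≡⟨ cong (λ u → (ι d + ι d) + (M * ι n - u)) (sym (ι-* m 3)) ⟩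
    (ι d + ι d) + (M * ι n - ι (m ℕ.* 3))                           ≡⟨ cong₂ (λ u v → u + (v - ι (m ℕ.* 3))) (sym (ι-+ d d)) (sym (ι-* m n)) ⟩
    ι (d ℕ.+ d) + (ι (m ℕ.* n) - ι (m ℕ.* 3))                       ≡⟨ regroup (ι (d ℕ.+ d)) (ι (m ℕ.* n)) (ι (m ℕ.* 3)) ⟩
    (ι (m ℕ.* n) + ι (d ℕ.+ d)) - ι (m ℕ.* 3)                       ≡⟨ cong (_- ι (m ℕ.* 3)) (sym (ι-+ (m ℕ.* n) (d ℕ.+ d))) ⟩
    ι (m ℕ.* n ℕ.+ (d ℕ.+ d)) - ι (m ℕ.* 3)                         ∎
    where
    open ≡-Reasoning
    open +-*-Solver
    M A : ℚ
    M = ι m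
    A = (+ n) / 2
    expand : ∀ M A o p h → M * ((A - o) + p) + M * ((A - o) + p) ≡
                           (M * (h + p) + M * (h + p)) + (M * (A + A) - M * ((o + o) + (h + h)))
    expand = solve 5 (λ M A o p h → (M :* ((A :- o) :+ p)) :+ (M :* ((A :- o) :+ p)) :=
                                    (M :* (h :+ p) :+ M :* (h :+ p)) :+ (M :* (A :+ A) :- M :* ((o :+ o) :+ (h :+ h)))) refl
    regroup : ∀ x y z → x + (y - z) ≡ (y + x) - z
    regroup = solve 3 (λ x y z → x :+ (y :- z) := (y :+ x) :- z) refl

  rational-bound : ∀ m n d N p → ι d ≡ ι m * (½ + p) → m ℕ.* n ℕ.+ (d ℕ.+ d) ℕ.< (N ℕ.+ N) ℕ.+ m ℕ.* 3 →
                   ι m * (((+ n) / 2 - 1ℚ) + p) < ι N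
  rational-bound m n d N p d≡ integer-bound = halve-< L (ι N) (begin-strict
    L + L                                      ≡⟨ twice-scaled m n d p d≡ ⟩
    ι (m ℕ.* n ℕ.+ (d ℕ.+ d)) - ι (m ℕ.* 3)    <⟨ move-right (subst (_ <_) (ι-+ (N ℕ.+ N) (m ℕ.* 3)) (ι-< integer-bound)) ⟩
    ι (N ℕ.+ N)                                ≡⟨ ι-+ N N ⟩
    ι N + ι N                                  ∎)
    where
    open ≤-Reasoning
    L : ℚ
    L = ι m * (((+ n) / 2 - 1ℚ) + p)

open import Defs
open import Data.Nat using (ℕ) renaming (_≤_ to _≤ℕ_)
open import Data.List using (length)
open import Data.Integer using (+_)
open import Data.Rational using (ℚ; _/_; 0ℚ; 1ℚ; ½; _+_; _-_; _*_; _<_; _≤_)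
open import Relation.Binary.PropositionalEquality using (_≡_)
open RationalBound using (rational-bound)
open IntegerBound using (integer-bound)

-- The theorem: the inequality over ℕ, read over ℚ.
lemma21 : (n : ℕ) (𝒜 ℬ : Family) → Counterexample n 𝒜 → IsComplementIn n 𝒜 ℬ →
    (p : ℚ) → 0ℚ ≤ p → p ≤ ½ →
    (i : ℕ) → 1 ≤ℕ i → i ≤ℕ n → (+ deg i ℬ) / 1 ≡ ((+ length ℬ) / 1) * (½ + p) →
    (𝓘 : Family) → IsInitialColex 𝓘 (length ℬ) →
    ((+ length ℬ) / 1) * (((+ n) / 2 - 1ℚ) + p) < (+ norm 𝓘) / 1
lemma21 n 𝒜 ℬ counterexample complement p _ _ i 1≤i i≤n deg≡ 𝓘 initial =
  rational-bound (length ℬ) n (deg i ℬ) (norm 𝓘) p deg≡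
    (integer-bound n 𝒜 ℬ counterexample complement i 1≤i i≤n 𝓘 initial)
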